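{- Let $\underline n=(n_0,n_1,\dots,n_k)$ be a sequence of nonnegative integers with $n_0+\dots+n_k=n$. Then $$\sum_{f\in\mathbb{Z}^n_e(\underline n)}p^{\ell_D(f)}a^{\mathrm{neg}(f)}=\frac12\,\frac{[n]_p!}{[n_0]_p!\,[n_1]_p!\cdots[n_k]_p!}\left\{\frac{(a;p)_n}{(a;p)_{n_0}}+\frac{(-a;p)_n}{(-a;p)_{n_0}}\right\}.$$
   Context: $B_n$ is the group of signed permutations of $[n]$ (bijections $\beta$ of $[-n,n]\setminus\{0\}$ with $\beta(-i)=-\beta(i)$), written $\beta=[\beta(1),\dots,\beta(n)]$; $\mathrm{neg}(\beta)=|\{i:\beta(i)<0\}|$. $D_n=\{\gamma\in B_n:\mathrm{neg}(\gamma)\text{ even}\}$. $\ell_B(\beta)=\mathrm{inv}(\beta)-\sum_{i:\beta(i)<0}\beta(i)$ with $\mathrm{inv}(\beta)=|\{(i,j):i<j,\ \beta(i)>\beta(j)\}|$ (the Coxeter length of type $B$), and $\ell_D(\gamma)=\ell_B(\gamma)-\mathrm{neg}(\gamma)$ for $\gamma\in D_n$. For $f=(f_1,\dots,f_n)\in\mathbb{Z}^n$, $\mathrm{neg}(f)=|\{i:f_i<0\}|$, and $\pi(f)\in B_n$ is the unique signed permutation $\beta$ with: (1) $|f_{|\beta(1)|}|\le\dots\le|f_{|\beta(n)|}|$; (2) $\beta(i)<0$ iff $f_{|\beta(i)|}<0$; (3) if $|f_{|\beta(i)|}|=|f_{|\beta(i+1)|}|$ then $\beta(i)<\beta(i+1)$.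 $\mathbb{Z}^n_e$ is the set of $f\in\mathbb{Z}^n$ with an even number of negative entries (so $\pi(f)\in D_n$), and $\ell_D(f):=\ell_D(\pi(f))$. $\mathbb{Z}^n_e(\underline n)=\{f\in\mathbb{Z}^n_e:\#\{i:|f_i|=j\}=n_j\text{ for }j=0,\dots,k\}$. Notation: $(x;p)_0=1$, $(x;p)_m=(1-x)(1-xp)\cdots(1-xp^{m-1})$; $[m]_p=1+p+\dots+p^{m-1}$, $[m]_p!=[m]_p\cdots[1]_p$, $[0]_p!=1$. -}

module Defs where

open import Data.Bool using (Bool; true; false; _∧_; if_then_else_)
open import Data.Nat as ℕ using (ℕ; zero; suc; _∸_; _≡ᵇ_)
open import Data.Nat.DivMod using (_%_)
open import Data.Integer as ℤ using (ℤ; +_; -_; ∣_∣; _<?_; _≟_; _≤?_)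
open import Data.List as List using (List; []; _∷_; _++_; map; concatMap; upTo; filterᵇ; reverse; length; allFin)
open import Data.Vec as Vec using (Vec)
open import Data.Fin using (Fin; toℕ)
open import Data.Product using (_×_; _,_; proj₁; proj₂)
open import Relation.Nullary.Decidable using (⌊_⌋)

countᵇ : {A : Set} → (A → Bool) → List A → ℕ
countᵇ P xs = length (filterᵇ P xs)

sumℤ : List ℤ → ℤ
sumℤ = List.foldr ℤ._+_ (+ 0)

prodℤ : List ℤ → ℤ
prodℤ = List.foldr ℤ._*_ (+ 1)

maxℕ : List ℕ → ℕ
maxℕ = List.foldr ℕ._⊔_ 0

-- signed permutations in one-line notation [β(1),…,β(n)] as lists of ℤ

negβ : List ℤ → ℕ
negβ = countᵇ (λ x → ⌊ x <? + 0 ⌋)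

inv : List ℤ → ℕ
inv []       = 0
inv (x ∷ xs) = countᵇ (λ y → ⌊ y <? x ⌋) xs ℕ.+ inv xs

ℓB : List ℤ → ℕ
ℓB β = inv β ℕ.+ List.foldr ℕ._+_ 0 (map ∣_∣ (filterᵇ (λ x → ⌊ x <? + 0 ⌋) β))

-- ℓ_D(γ) = ℓ_B(γ) - neg(γ)   (ℓ_B ≥ neg, so truncated subtraction is exact)
ℓD : List ℤ → ℕ
ℓD γ = ℓB γ ∸ negβ γ

-- f ∈ ℤ^n as a list [f_1,…,f_n]

negf : List ℤ → ℕ
negf = countᵇ (λ x → ⌊ x <? + 0 ⌋)

-- pairs (i , f_i) with 1-based index i
indexed : List ℤ → List (ℕ × ℤ)
indexed f = List.zip (List.map suc (upTo (length f))) f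

-- π(f): listed block by block for j = 0,1,…,max|f_i|  (condition (1));
-- in block j first the entries -i with f_i = -j < 0, in increasing order
-- of -i (i decreasing), then the entries +i with f_i = j ≥ 0 in increasing
-- order of i.  Signs are as in condition (2), and within a block of equal
-- |f| the values β(i) increase, which is condition (3).
πblock : List ℤ → ℕ → List ℤ
πblock f j =
  reverse (map (λ q → - (+ proj₁ q))
    (filterᵇ (λ q → ⌊ proj₂ q ≟ - (+ j) ⌋ ∧ ⌊ proj₂ q <? + 0 ⌋) (indexed f)))
  ++ map (λ q → + proj₁ q)
    (filterᵇ (λ q → ⌊ proj₂ q ≟ + j ⌋) (indexed f))

π : List ℤ → List ℤ
π f = concatMap (πblock f) (upTo (suc (maxℕ (map ∣_∣ f))))

ℓDf : List ℤ → ℕ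
ℓDf f = ℓD (π f)

tuples : ℕ → List ℤ → List (List ℤ)
tuples zero    xs = [] ∷ []
tuples (suc n) xs = concatMap (λ x → map (x ∷_) (tuples n xs)) xs

range : ℕ → List ℤ
range k = map (λ i → (+ i) ℤ.- (+ k)) (upTo (suc (k ℕ.+ k)))

hasCounts : {k : ℕ} → Vec ℕ (suc k) → List ℤ → Bool
hasCounts {k} ns f =
  List.foldr _∧_ true (map (λ (j : Fin (suc k)) → countᵇ (λ x → ∣ x ∣ ≡ᵇ toℕ j) f ≡ᵇ Vec.lookup ns j)
           (allFin (suc k)))

evenᵇ : ℕ → Bool
evenᵇ m = (m % 2) ≡ᵇ 0

-- ℤ^n_e(n) (entries of such f automatically satisfy |f_i| ≤ k when Σ n_j = n)
Zne : (n : ℕ) {k : ℕ} → Vec ℕ (suc k) → List (List ℤ)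
Zne n {k} ns = filterᵇ (λ f → evenᵇ (negf f) ∧ hasCounts ns f) (tuples n (range k))

genSum : (n : ℕ) {k : ℕ} → Vec ℕ (suc k) → ℤ → ℤ → ℤ
genSum n ns p a = sumℤ (map (λ f → (p ℤ.^ ℓDf f) ℤ.* (a ℤ.^ negf f)) (Zne n ns))

poch : ℤ → ℤ → ℕ → ℤ
poch x p m = prodℤ (map (λ i → (+ 1) ℤ.- x ℤ.* (p ℤ.^ i)) (upTo m))

qint : ℕ → ℤ → ℤ
qint m p = sumℤ (map (p ℤ.^_) (upTo m))

qfact : ℕ → ℤ → ℤ
qfact zero    p = + 1
qfact (suc m) p = qint (suc m) p ℤ.* qfact m p

module Submission where

-- Drop the parity condition and weight negative entries by an arbitrary b:
-- H_n(v) = Σ p^{ℓ_D(f)} b^{neg(f)} over the words f ∈ [-k,k]^n with content v.  Since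
-- (-a)^m = ±a^m according to the parity of m, twice the left-hand side is H_n(v) at b = a
-- plus H_n(v) at b = -a (module Parity).  The core claim is the product formula
--   Π_j [v_j]_p! · H_n(v) · (-b;p)_{v_0} = [n]_p! · (-b;p)_n        (ProductFormula),
-- by induction on n, splitting off the last letter x of f.  Its index n is the largest,
-- so in π(f) it is the last entry of block |x| if x ≥ 0 and the first one if x < 0
-- (Blocks), and ℓ_D grows by the number of entries in later blocks, resp. in earlier
-- blocks plus n (CoxeterLength).  The resulting recurrence for H_n(v) (Recurrence) sums
-- over the letters by q-integer telescoping (QAlgebra) to the factor [n+1]_p (1 + b p^n).

open import Defs
open import Data.Bool using (Bool; true; false; _∧_; if_then_else_; T)
open import Data.Nat as ℕ using (ℕ; zero; suc; _∸_; _≡ᵇ_; _≤_; _<_; z≤n; s≤s)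
import Data.Nat.Properties as ℕₚ
open import Data.Integer as ℤ using (ℤ; +_; -_; -[1+_]; ∣_∣; _<?_; _≟_)
import Data.Integer.Properties as ℤₚ
open import Data.List using (List; []; _∷_; _++_; _∷ʳ_; map; concat; concatMap; filterᵇ; applyUpTo; upTo; length; reverse; zip; replicate)
import Data.List.Properties as Listₚ
open import Data.List.Relation.Unary.All as All using (All; []; _∷_)
open import Data.List.Relation.Unary.All.Properties using (++⁺; ++⁻ˡ; ++⁻ʳ; ∷ʳ⁺; map⁺; concat⁺; filter⁺; applyUpTo⁺₁; applyUpTo⁺₂)
open import Data.Product using (_×_; _,_; proj₁; proj₂)
open import Function using (_∘_)
open import Relation.Nullary using (¬_; Dec; yes; no)
open import Relation.Nullary.Decidable using (⌊_⌋)
open import Data.Empty using (⊥-elim)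
open import Relation.Binary.PropositionalEquality

module Sums where
  open import Data.Integer using (_+_; _*_)
  open import Data.Integer.Tactic.RingSolver using (solve-∀)

  sumOver : {A : Set} → List A → (A → ℤ) → ℤ
  sumOver xs g = sumℤ (map g xs)

  syntax sumOver xs (λ x → e) = ∑[ x ∈ xs ] e

  when : Bool → ℤ → ℤ
  when b z = if b then z else + 0

  private variable A B : Set

  ∑-++ : (xs ys : List A) (g : A → ℤ) → sumOver (xs ++ ys) g ≡ sumOver xs g + sumOver ys g
  ∑-++ []       ys g = sym (ℤₚ.+-identityˡ _)
  ∑-++ (x ∷ xs) ys g = trans (cong (_+_ (g x)) (∑-++ xs ys g)) (sym (ℤₚ.+-assoc (g x) _ _))

  ∑-concatMap : (h : A → List B) (xs : List A) (g : B → ℤ) →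
    sumOver (concatMap h xs) g ≡ ∑[ x ∈ xs ] sumOver (h x) g
  ∑-concatMap h []       g = refl
  ∑-concatMap h (x ∷ xs) g = trans (∑-++ (h x) (concatMap h xs) g) (cong (_+_ (sumOver (h x) g)) (∑-concatMap h xs g))

  ∑-map : (h : A → B) (xs : List A) (g : B → ℤ) → sumOver (map h xs) g ≡ ∑[ x ∈ xs ] g (h x)
  ∑-map h []       g = refl
  ∑-map h (x ∷ xs) g = cong (_+_ (g (h x))) (∑-map h xs g)

  ∑-filterᵇ : (P : A → Bool) (xs : List A) (g : A → ℤ) → sumOver (filterᵇ P xs) g ≡ ∑[ x ∈ xs ] when (P x) (g x)
  ∑-filterᵇ P []       g = refl
  ∑-filterᵇ P (x ∷ xs) g with P x
  ... | true  = cong (_+_ (g x)) (∑-filterᵇ P xs g)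
  ... | false = trans (∑-filterᵇ P xs g) (sym (ℤₚ.+-identityˡ _))

  ∑-cong : {g h : A → ℤ} (xs : List A) → (∀ x → g x ≡ h x) → sumOver xs g ≡ sumOver xs h
  ∑-cong []       e = refl
  ∑-cong (x ∷ xs) e = cong₂ _+_ (e x) (∑-cong xs e)

  ∑-congᴬ : {g h : A → ℤ} (xs : List A) → All (λ x → g x ≡ h x) xs → sumOver xs g ≡ sumOver xs h
  ∑-congᴬ []       []       = refl
  ∑-congᴬ (x ∷ xs) (e ∷ es) = cong₂ _+_ e (∑-congᴬ xs es)

  ∑-+ : (xs : List A) (g h : A → ℤ) → ∑[ x ∈ xs ] (g x + h x) ≡ sumOver xs g + sumOver xs h
  ∑-+ []       g h = refl
  ∑-+ (x ∷ xs) g h = trans (cong (_+_ (g x + h x)) (∑-+ xs g h)) (interchange (g x) (h x) _ _)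
    where
    interchange : ∀ a b c d → (a + b) + (c + d) ≡ (a + c) + (b + d)
    interchange = solve-∀

  ∑-*ˡ : (xs : List A) (c : ℤ) (g : A → ℤ) → ∑[ x ∈ xs ] (c * g x) ≡ c * sumOver xs g
  ∑-*ˡ []       c g = sym (ℤₚ.*-zeroʳ c)
  ∑-*ˡ (x ∷ xs) c g = trans (cong (_+_ (c * g x)) (∑-*ˡ xs c g)) (sym (ℤₚ.*-distribˡ-+ c (g x) _))

  ∑-*ʳ : (xs : List A) (g : A → ℤ) (c : ℤ) → ∑[ x ∈ xs ] (g x * c) ≡ sumOver xs g * c
  ∑-*ʳ xs g c = trans (∑-cong xs (λ x → ℤₚ.*-comm (g x) c)) (trans (∑-*ˡ xs c g) (ℤₚ.*-comm c _))

  ∑-zero : (xs : List A) → ∑[ x ∈ xs ] (+ 0) ≡ + 0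
  ∑-zero []       = refl
  ∑-zero (x ∷ xs) = trans (ℤₚ.+-identityˡ _) (∑-zero xs)

  ∑-swap : (xs : List A) (ys : List B) (h : A → B → ℤ) →
    ∑[ x ∈ xs ] sumOver ys (h x) ≡ ∑[ y ∈ ys ] ∑[ x ∈ xs ] h x y
  ∑-swap []       ys h = sym (∑-zero ys)
  ∑-swap (x ∷ xs) ys h = trans (cong (_+_ (sumOver ys (h x))) (∑-swap xs ys h)) (sym (∑-+ ys (h x) _))

  ∑-tuples-∷ʳ : (xs : List ℤ) (n : ℕ) (g : List ℤ → ℤ) →
    sumOver (tuples (suc n) xs) g ≡ ∑[ f ∈ tuples n xs ] ∑[ x ∈ xs ] g (f ∷ʳ x)
  ∑-tuples-∷ʳ xs zero g = trans (∑-concatMap _ xs g) (trans (∑-cong xs (λ x → ℤₚ.+-identityʳ (g (x ∷ [])))) (sym (ℤₚ.+-identityʳ _)))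
  ∑-tuples-∷ʳ xs (suc n) g = begin
    sumOver (tuples (suc (suc n)) xs) g                           ≡⟨ ∑-concatMap _ xs g ⟩
    ∑[ y ∈ xs ] sumOver (map (y ∷_) (tuples (suc n) xs)) g         ≡⟨ ∑-cong xs (λ y → ∑-map (y ∷_) (tuples (suc n) xs) g) ⟩
    ∑[ y ∈ xs ] sumOver (tuples (suc n) xs) (g ∘ (y ∷_))           ≡⟨ ∑-cong xs (λ y → ∑-tuples-∷ʳ xs n (g ∘ (y ∷_))) ⟩
    ∑[ y ∈ xs ] ∑[ f ∈ tuples n xs ] lastLetter (y ∷ f)            ≡⟨ ∑-cong xs (λ y → sym (∑-map (y ∷_) (tuples n xs) lastLetter)) ⟩
    ∑[ y ∈ xs ] sumOver (map (y ∷_) (tuples n xs)) lastLetter     ≡⟨ sym (∑-concatMap _ xs lastLetter) ⟩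
    sumOver (tuples (suc n) xs) lastLetter                         ∎
    where
    open ≡-Reasoning
    lastLetter : List ℤ → ℤ
    lastLetter f = ∑[ x ∈ xs ] g (f ∷ʳ x)

  tuples-All : {Q : ℤ → Set} (xs : List ℤ) → All Q xs → (n : ℕ) →
    All (λ f → All Q f × length f ≡ n) (tuples n xs)
  tuples-All         xs qs zero    = ([] , refl) ∷ []
  tuples-All {Q = Q} xs qs (suc n) = prepend-all xs qs
    where
    prepend-all : (ys : List ℤ) → All Q ys → All (λ f → All Q f × length f ≡ suc n) (concatMap (λ x → map (x ∷_) (tuples n xs)) ys)
    prepend-all []       []        = []
    prepend-all (y ∷ ys) (qy ∷ qys) =
      ++⁺ (map⁺ (All.map (λ (qf , lf) → qy ∷ qf , cong suc lf) (tuples-All xs qs n))) (prepend-all ys qys)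

module ListFacts where
  open import Data.Nat using (_+_)
  open import Data.Nat.ListAction using (sum)
  open import Data.Nat.Tactic.RingSolver using (solve-∀)
  open import Relation.Unary using (Pred; Decidable)
  open import Relation.Nullary.Decidable using (T?)
  open import Level using (0ℓ)

  private variable A B : Set

  indicator : Bool → ℕ
  indicator true  = 1
  indicator false = 0

  countᵇ-∷ : (P : A → Bool) (x : A) (xs : List A) → countᵇ P (x ∷ xs) ≡ indicator (P x) + countᵇ P xs
  countᵇ-∷ P x xs with P x
  ... | true  = refl
  ... | false = refl

  filterᵇ-++ : (P : A → Bool) (xs ys : List A) → filterᵇ P (xs ++ ys) ≡ filterᵇ P xs ++ filterᵇ P ys
  filterᵇ-++ P = Listₚ.filter-++ (λ x → T? (P x))

  countᵇ-++ : (P : A → Bool) (xs ys : List A) → countᵇ P (xs ++ ys) ≡ countᵇ P xs + countᵇ P ys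
  countᵇ-++ P xs ys = trans (cong length (filterᵇ-++ P xs ys)) (Listₚ.length-++ (filterᵇ P xs))

  filterᵇ-∷ʳ-accept : (P : A → Bool) (xs : List A) (x : A) → P x ≡ true → filterᵇ P (xs ∷ʳ x) ≡ filterᵇ P xs ∷ʳ x
  filterᵇ-∷ʳ-accept P xs x Px rewrite filterᵇ-++ P xs (x ∷ []) | Px = refl

  filterᵇ-∷ʳ-reject : (P : A → Bool) (xs : List A) (x : A) → P x ≡ false → filterᵇ P (xs ∷ʳ x) ≡ filterᵇ P xs
  filterᵇ-∷ʳ-reject P xs x Px rewrite filterᵇ-++ P xs (x ∷ []) | Px = Listₚ.++-identityʳ _

  filterᵇ-none : (P : A → Bool) (xs : List A) → All (λ x → P x ≡ false) xs → filterᵇ P xs ≡ []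
  filterᵇ-none P []       []         = refl
  filterᵇ-none P (x ∷ xs) (Px ∷ Pxs) rewrite Px = filterᵇ-none P xs Pxs

  module _ {P : Pred A 0ℓ} (P? : Decidable P) where

    count-all : (xs : List A) → All P xs → countᵇ (λ x → ⌊ P? x ⌋) xs ≡ length xs
    count-all []       []         = refl
    count-all (x ∷ xs) (px ∷ pxs) with P? x
    ... | yes _  = cong suc (count-all xs pxs)
    ... | no ¬px = ⊥-elim (¬px px)

    count-none : (xs : List A) → All (¬_ ∘ P) xs → countᵇ (λ x → ⌊ P? x ⌋) xs ≡ 0
    count-none []       []           = refl
    count-none (x ∷ xs) (¬px ∷ ¬pxs) with P? x
    ... | yes px = ⊥-elim (¬px px)
    ... | no _   = count-none xs ¬pxs

  countᵇ-zip₂ : (P : B → Bool) (xs : List A) (ys : List B) → length xs ≡ length ys →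
    countᵇ (P ∘ proj₂) (zip xs ys) ≡ countᵇ P ys
  countᵇ-zip₂ P []       []       _ = refl
  countᵇ-zip₂ P (x ∷ xs) (y ∷ ys) e =
    trans (countᵇ-∷ (P ∘ proj₂) (x , y) (zip xs ys))
      (trans (cong (_+_ (indicator (P y))) (countᵇ-zip₂ P xs ys (ℕₚ.suc-injective e))) (sym (countᵇ-∷ P y ys)))

  countᵇ-+ : (P Q R : A → Bool) → (∀ y → indicator (P y) + indicator (Q y) ≡ indicator (R y)) → (xs : List A) →
    countᵇ P xs + countᵇ Q xs ≡ countᵇ R xs
  countᵇ-+ P Q R split []       = refl
  countᵇ-+ P Q R split (x ∷ xs) = begin
    countᵇ P (x ∷ xs) + countᵇ Q (x ∷ xs)                                 ≡⟨ cong₂ _+_ (countᵇ-∷ P x xs) (countᵇ-∷ Q x xs) ⟩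
    (indicator (P x) + countᵇ P xs) + (indicator (Q x) + countᵇ Q xs)     ≡⟨ interchange (indicator (P x)) _ _ _ ⟩
    (indicator (P x) + indicator (Q x)) + (countᵇ P xs + countᵇ Q xs)     ≡⟨ cong₂ _+_ (split x) (countᵇ-+ P Q R split xs) ⟩
    indicator (R x) + countᵇ R xs                                         ≡⟨ sym (countᵇ-∷ R x xs) ⟩
    countᵇ R (x ∷ xs)                                                     ∎
    where
    open ≡-Reasoning
    interchange : ∀ a b c d → (a + b) + (c + d) ≡ (a + c) + (b + d)
    interchange = solve-∀

  zip-∷ʳ : (xs : List A) (ys : List B) (a : A) (b : B) → length xs ≡ length ys →
    zip (xs ∷ʳ a) (ys ∷ʳ b) ≡ zip xs ys ∷ʳ (a , b)
  zip-∷ʳ []       []       a b e = refl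
  zip-∷ʳ (x ∷ xs) (y ∷ ys) a b e = cong ((x , y) ∷_) (zip-∷ʳ xs ys a b (ℕₚ.suc-injective e))

  All-zip₁ : {Q : A → Set} (xs : List A) (ys : List B) → All Q xs → All (Q ∘ proj₁) (zip xs ys)
  All-zip₁ []       ys       []         = []
  All-zip₁ (x ∷ xs) []       (_ ∷ _)    = []
  All-zip₁ (x ∷ xs) (y ∷ ys) (qx ∷ qxs) = qx ∷ All-zip₁ xs ys qxs

  All-zip₂ : {Q : B → Set} (xs : List A) (ys : List B) → All Q ys → All (Q ∘ proj₂) (zip xs ys)
  All-zip₂ []       ys       _          = []
  All-zip₂ (x ∷ xs) []       []         = []
  All-zip₂ (x ∷ xs) (y ∷ ys) (qy ∷ qys) = qy ∷ All-zip₂ xs ys qys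

  All-reverse : {Q : A → Set} (xs : List A) → All Q xs → All Q (reverse xs)
  All-reverse []       []         = []
  All-reverse (x ∷ xs) (qx ∷ qxs) = subst (All _) (sym (Listₚ.unfold-reverse x xs)) (∷ʳ⁺ (All-reverse xs qxs) qx)

  applyUpTo-cong : (g h : ℕ → A) (d : ℕ) → (∀ i → i < d → g i ≡ h i) → applyUpTo g d ≡ applyUpTo h d
  applyUpTo-cong g h zero    e = refl
  applyUpTo-cong g h (suc d) e =
    cong₂ _∷_ (e 0 (s≤s z≤n)) (applyUpTo-cong (g ∘ suc) (h ∘ suc) d (λ i i<d → e (suc i) (s≤s i<d)))

  applyUpTo-+ : (g : ℕ → A) (a d : ℕ) → applyUpTo g (a + d) ≡ applyUpTo g a ++ applyUpTo (λ i → g (a + i)) d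
  applyUpTo-+ g zero    d = refl
  applyUpTo-+ g (suc a) d = cong (g 0 ∷_) (applyUpTo-+ (g ∘ suc) a d)

  applyUpTo-split : (g : ℕ → A) (j k : ℕ) → j ≤ k →
    applyUpTo g (suc k) ≡ applyUpTo g j ++ g j ∷ applyUpTo (λ i → g (suc (j + i))) (k ∸ j)
  applyUpTo-split g zero    k       _         = refl
  applyUpTo-split g (suc j) (suc k) (s≤s j≤k) = cong (g 0 ∷_) (applyUpTo-split (g ∘ suc) j k j≤k)

  length-concat-applyUpTo : (g : ℕ → List A) (d : ℕ) → length (concat (applyUpTo g d)) ≡ sum (applyUpTo (length ∘ g) d)
  length-concat-applyUpTo g zero    = refl
  length-concat-applyUpTo g (suc d) = trans (Listₚ.length-++ (g 0)) (cong (_+_ (length (g 0))) (length-concat-applyUpTo (g ∘ suc) d))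

  concat-applyUpTo-[] : (g : ℕ → List A) (d : ℕ) → (∀ i → g i ≡ []) → concat (applyUpTo g d) ≡ []
  concat-applyUpTo-[] g zero    e = refl
  concat-applyUpTo-[] g (suc d) e rewrite e 0 = concat-applyUpTo-[] (g ∘ suc) d (e ∘ suc)

module CoxeterLength where
  open import Data.Nat using (_+_)
  open import Data.Nat.ListAction using (sum)
  open import Data.Nat.ListAction.Properties using (sum-++)
  open import Data.Nat.Tactic.RingSolver using (solve-∀)
  open ListFacts

  negᵇ : ℤ → Bool
  negᵇ x = ⌊ x <? + 0 ⌋

  negSum : List ℤ → ℕ
  negSum β = sum (map ∣_∣ (filterᵇ negᵇ β))

  negPart : ℤ → ℕ
  negPart (+ _)     = 0
  negPart -[1+ n ]  = suc n

  negSum-∷ : (x : ℤ) (β : List ℤ) → negSum (x ∷ β) ≡ negPart x + negSum β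
  negSum-∷ (+ _)     β = refl
  negSum-∷ -[1+ _ ]  β = refl

  negSum-++ : (xs ys : List ℤ) → negSum (xs ++ ys) ≡ negSum xs + negSum ys
  negSum-++ xs ys rewrite filterᵇ-++ negᵇ xs ys | Listₚ.map-++ ∣_∣ (filterᵇ negᵇ xs) (filterᵇ negᵇ ys) =
    sum-++ (map ∣_∣ (filterᵇ negᵇ xs)) (map ∣_∣ (filterᵇ negᵇ ys))

  -- Each negative entry contributes at least 1 to negSum, so ℓ_D = ℓ_B - neg loses nothing.
  negβ≤negSum : (β : List ℤ) → negβ β ≤ negSum β
  negβ≤negSum []             = z≤n
  negβ≤negSum (+ _ ∷ β)      = negβ≤negSum β
  negβ≤negSum (-[1+ n ] ∷ β) = ℕₚ.+-mono-≤ (s≤s z≤n) (negβ≤negSum β)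

  negβ≤ℓB : (β : List ℤ) → negβ β ≤ ℓB β
  negβ≤ℓB β = ℕₚ.≤-trans (negβ≤negSum β) (ℕₚ.m≤n+m (negSum β) (inv β))

  inv-insert : (L1 : List ℤ) (e : ℤ) (L2 : List ℤ) →
    inv (L1 ++ e ∷ L2) ≡ inv (L1 ++ L2) + (countᵇ (λ y → ⌊ e <? y ⌋) L1 + countᵇ (λ y → ⌊ y <? e ⌋) L2)
  inv-insert []       e L2 = ℕₚ.+-comm (countᵇ (λ y → ⌊ y <? e ⌋) L2) (inv L2)
  inv-insert (a ∷ L1) e L2 = begin
    countᵇ (λ y → ⌊ y <? a ⌋) (L1 ++ e ∷ L2) + inv (L1 ++ e ∷ L2)
      ≡⟨ cong₂ _+_ (trans (countᵇ-++ _ L1 (e ∷ L2)) (cong (_+_ c₁) (countᵇ-∷ _ e L2))) (inv-insert L1 e L2) ⟩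
    (c₁ + (t + c₂)) + (inv (L1 ++ L2) + (d₁ + d₂))
      ≡⟨ regroup c₁ t c₂ (inv (L1 ++ L2)) d₁ d₂ ⟩
    ((c₁ + c₂) + inv (L1 ++ L2)) + ((t + d₁) + d₂)
      ≡⟨ sym (cong₂ _+_ (cong (_+ inv (L1 ++ L2)) (countᵇ-++ _ L1 L2)) (cong (_+ d₂) (countᵇ-∷ (λ y → ⌊ e <? y ⌋) a L1))) ⟩
    (countᵇ (λ y → ⌊ y <? a ⌋) (L1 ++ L2) + inv (L1 ++ L2)) + (countᵇ (λ y → ⌊ e <? y ⌋) (a ∷ L1) + d₂) ∎
    where
    open ≡-Reasoning
    c₁ = countᵇ (λ y → ⌊ y <? a ⌋) L1
    c₂ = countᵇ (λ y → ⌊ y <? a ⌋) L2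
    t  = indicator ⌊ e <? a ⌋
    d₁ = countᵇ (λ y → ⌊ e <? y ⌋) L1
    d₂ = countᵇ (λ y → ⌊ y <? e ⌋) L2
    regroup : ∀ c₁ t c₂ I d₁ d₂ → (c₁ + (t + c₂)) + (I + (d₁ + d₂)) ≡ ((c₁ + c₂) + I) + ((t + d₁) + d₂)
    regroup = solve-∀

  ℓB-insert : (L1 : List ℤ) (e : ℤ) (L2 : List ℤ) →
    ℓB (L1 ++ e ∷ L2) ≡ ℓB (L1 ++ L2) + ((countᵇ (λ y → ⌊ e <? y ⌋) L1 + countᵇ (λ y → ⌊ y <? e ⌋) L2) + negPart e)
  ℓB-insert L1 e L2 = begin
    inv (L1 ++ e ∷ L2) + negSum (L1 ++ e ∷ L2)
      ≡⟨ cong₂ _+_ (inv-insert L1 e L2) (trans (negSum-++ L1 (e ∷ L2)) (cong (_+_ (negSum L1)) (negSum-∷ e L2))) ⟩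
    (inv (L1 ++ L2) + c) + (negSum L1 + (negPart e + negSum L2))
      ≡⟨ regroup (inv (L1 ++ L2)) c (negSum L1) (negPart e) (negSum L2) ⟩
    (inv (L1 ++ L2) + (negSum L1 + negSum L2)) + (c + negPart e)
      ≡⟨ cong (λ s → (inv (L1 ++ L2) + s) + (c + negPart e)) (sym (negSum-++ L1 L2)) ⟩
    ℓB (L1 ++ L2) + (c + negPart e) ∎
    where
    open ≡-Reasoning
    c = countᵇ (λ y → ⌊ e <? y ⌋) L1 + countᵇ (λ y → ⌊ y <? e ⌋) L2
    regroup : ∀ I c s₁ x s₂ → (I + c) + (s₁ + (x + s₂)) ≡ (I + (s₁ + s₂)) + (c + x)
    regroup = solve-∀

  negβ-insert : (L1 : List ℤ) (e : ℤ) (L2 : List ℤ) → negβ (L1 ++ e ∷ L2) ≡ indicator (negᵇ e) + negβ (L1 ++ L2)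
  negβ-insert L1 e L2 = begin
    negβ (L1 ++ e ∷ L2)                          ≡⟨ countᵇ-++ negᵇ L1 (e ∷ L2) ⟩
    negβ L1 + negβ (e ∷ L2)                      ≡⟨ cong (_+_ (negβ L1)) (countᵇ-∷ negᵇ e L2) ⟩
    negβ L1 + (indicator (negᵇ e) + negβ L2)     ≡⟨ leftComm (negβ L1) (indicator (negᵇ e)) (negβ L2) ⟩
    indicator (negᵇ e) + (negβ L1 + negβ L2)     ≡⟨ cong (_+_ (indicator (negᵇ e))) (sym (countᵇ-++ negᵇ L1 L2)) ⟩
    indicator (negᵇ e) + negβ (L1 ++ L2)         ∎
    where
    open ≡-Reasoning
    leftComm : ∀ a b c → a + (b + c) ≡ b + (a + c)
    leftComm = solve-∀

  -- A new largest (positive) value m is inverted with everything after it.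
  ℓD-insert-max : (L1 L2 : List ℤ) (m : ℕ) → All (ℤ._< + m) (L1 ++ L2) →
    ℓD (L1 ++ + m ∷ L2) ≡ ℓD (L1 ++ L2) + length L2
  ℓD-insert-max L1 L2 m below = begin
    ℓB (L1 ++ + m ∷ L2) ∸ negβ (L1 ++ + m ∷ L2)
      ≡⟨ cong₂ _∸_ (ℓB-insert L1 (+ m) L2) (negβ-insert L1 (+ m) L2) ⟩
    (ℓB (L1 ++ L2) + ((countᵇ (λ y → ⌊ + m <? y ⌋) L1 + countᵇ (λ y → ⌊ y <? + m ⌋) L2) + 0)) ∸ negβ (L1 ++ L2)
      ≡⟨ cong (λ c → (ℓB (L1 ++ L2) + c) ∸ negβ (L1 ++ L2)) (cong₂ (λ a b → (a + b) + 0) none all) ⟩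
    (ℓB (L1 ++ L2) + (length L2 + 0)) ∸ negβ (L1 ++ L2)
      ≡⟨ cong (λ c → (ℓB (L1 ++ L2) + c) ∸ negβ (L1 ++ L2)) (ℕₚ.+-identityʳ (length L2)) ⟩
    (ℓB (L1 ++ L2) + length L2) ∸ negβ (L1 ++ L2)
      ≡⟨ ℕₚ.+-∸-comm (length L2) (negβ≤ℓB (L1 ++ L2)) ⟩
    ℓD (L1 ++ L2) + length L2 ∎
    where
    open ≡-Reasoning
    none = count-none (+ m <?_) L1 (All.map ℤₚ.<-asym (++⁻ˡ L1 below))
    all  = count-all (_<? + m) L2 (++⁻ʳ L1 below)

  -- A new smallest (negative) value -(n+1) is inverted with everything before it,
  -- and contributes n+1 to ℓ_B and 1 to neg.
  ℓD-insert-min : (L1 L2 : List ℤ) (n : ℕ) → All (-[1+ n ] ℤ.<_) (L1 ++ L2) →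
    ℓD (L1 ++ -[1+ n ] ∷ L2) ≡ ℓD (L1 ++ L2) + (length L1 + n)
  ℓD-insert-min L1 L2 n above = begin
    ℓB (L1 ++ -[1+ n ] ∷ L2) ∸ negβ (L1 ++ -[1+ n ] ∷ L2)
      ≡⟨ cong₂ _∸_ (ℓB-insert L1 -[1+ n ] L2) (negβ-insert L1 -[1+ n ] L2) ⟩
    (ℓB (L1 ++ L2) + ((countᵇ (λ y → ⌊ -[1+ n ] <? y ⌋) L1 + countᵇ (λ y → ⌊ y <? -[1+ n ] ⌋) L2) + suc n)) ∸ suc (negβ (L1 ++ L2))
      ≡⟨ cong (λ c → (ℓB (L1 ++ L2) + c) ∸ suc (negβ (L1 ++ L2))) (cong₂ (λ a b → (a + b) + suc n) all none) ⟩
    (ℓB (L1 ++ L2) + ((length L1 + 0) + suc n)) ∸ suc (negβ (L1 ++ L2))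
      ≡⟨ cong (_∸ suc (negβ (L1 ++ L2))) (regroup (ℓB (L1 ++ L2)) (length L1) n) ⟩
    (ℓB (L1 ++ L2) + (length L1 + n)) ∸ negβ (L1 ++ L2)
      ≡⟨ ℕₚ.+-∸-comm (length L1 + n) (negβ≤ℓB (L1 ++ L2)) ⟩
    ℓD (L1 ++ L2) + (length L1 + n) ∎
    where
    open ≡-Reasoning
    all  = count-all (-[1+ n ] <?_) L1 (++⁻ˡ L1 above)
    none = count-none (_<? -[1+ n ]) L2 (All.map ℤₚ.<-asym (++⁻ʳ L1 above))
    regroup : ∀ ℓ l n → ℓ + ((l + 0) + suc n) ≡ suc (ℓ + (l + n))
    regroup = solve-∀

-- π(f) is the concatenation of the blocks πblock f 0, πblock f 1, ...; appending a
-- letter x to f (the new largest index n+1) changes only block |x|, putting +(n+1)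
-- at its end if x ≥ 0 and -(n+1) at its front if x < 0.  With the insertion lemmas
-- this gives the change of ℓ_D(f) in terms of the block sizes #{i : |f_i| = j}.
module Blocks where
  open import Data.Nat using (_+_)
  open import Data.Nat.ListAction using (sum)
  open import Data.Bool.Properties using (∧-zeroʳ)
  open import Relation.Nullary.Decidable using (isYes≗does; dec-true; dec-false)
  open ListFacts
  open CoxeterLength

  mult : ℕ → List ℤ → ℕ
  mult j f = countᵇ (λ y → ∣ y ∣ ≡ᵇ j) f

  ≡ᵇ-refl : (m : ℕ) → (m ≡ᵇ m) ≡ true
  ≡ᵇ-refl zero    = refl
  ≡ᵇ-refl (suc m) = ≡ᵇ-refl m

  ≡ᵇ-false : (m n : ℕ) → ¬ m ≡ n → (m ≡ᵇ n) ≡ false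
  ≡ᵇ-false zero    zero    m≢n = ⊥-elim (m≢n refl)
  ≡ᵇ-false zero    (suc n) m≢n = refl
  ≡ᵇ-false (suc m) zero    m≢n = refl
  ≡ᵇ-false (suc m) (suc n) m≢n = ≡ᵇ-false m n (m≢n ∘ cong suc)

  isNegᵇ : ℕ → ℤ → Bool
  isNegᵇ j y = ⌊ y ≟ - (+ j) ⌋ ∧ ⌊ y <? + 0 ⌋

  isPosᵇ : ℕ → ℤ → Bool
  isPosᵇ j y = ⌊ y ≟ + j ⌋

  isNeg-+ : (j a : ℕ) → isNegᵇ j (+ a) ≡ false
  isNeg-+ j a = ∧-zeroʳ _

  isNeg-self : (i : ℕ) → isNegᵇ (suc i) -[1+ i ] ≡ true
  isNeg-self i rewrite isYes≗does (-[1+ i ] ≟ -[1+ i ]) | dec-true (-[1+ i ] ≟ -[1+ i ]) refl = refl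

  isPos-self : (j : ℕ) → isPosᵇ j (+ j) ≡ true
  isPos-self j = trans (isYes≗does (+ j ≟ + j)) (dec-true (+ j ≟ + j) refl)

  isNeg-other : (j : ℕ) (y : ℤ) → ¬ ∣ y ∣ ≡ j → isNegᵇ j y ≡ false
  isNeg-other j y ≢j rewrite isYes≗does (y ≟ - (+ j))
    | dec-false (y ≟ - (+ j)) (λ y≡-j → ≢j (trans (cong ∣_∣ y≡-j) (ℤₚ.∣-i∣≡∣i∣ (+ j)))) = refl

  isPos-other : (j : ℕ) (y : ℤ) → ¬ ∣ y ∣ ≡ j → isPosᵇ j y ≡ false
  isPos-other j y ≢j = trans (isYes≗does (y ≟ + j)) (dec-false (y ≟ + j) (≢j ∘ cong ∣_∣))

  block-tests : (j : ℕ) (y : ℤ) → indicator (isNegᵇ j y) + indicator (isPosᵇ j y) ≡ indicator (∣ y ∣ ≡ᵇ j)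
  block-tests j (+ a) = by-cases (a ℕₚ.≟ j)
    where
    by-cases : Dec (a ≡ j) → indicator (isNegᵇ j (+ a)) + indicator (isPosᵇ j (+ a)) ≡ indicator (a ≡ᵇ j)
    by-cases (yes refl) rewrite isNeg-+ a a | isPos-self a | ≡ᵇ-refl a = refl
    by-cases (no a≢j)   rewrite isNeg-+ j a | isPos-other j (+ a) a≢j | ≡ᵇ-false a j a≢j = refl
  block-tests zero -[1+ a ] rewrite isNeg-other zero -[1+ a ] (λ ()) = refl
  block-tests (suc j) -[1+ a ] = by-cases (a ℕₚ.≟ j)
    where
    by-cases : Dec (a ≡ j) → indicator (isNegᵇ (suc j) -[1+ a ]) + 0 ≡ indicator (a ≡ᵇ j)
    by-cases (yes refl) rewrite isNeg-self a | ≡ᵇ-refl a = refl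
    by-cases (no a≢j)   rewrite isNeg-other (suc j) -[1+ a ] (a≢j ∘ ℕₚ.suc-injective) | ≡ᵇ-false a j a≢j = refl

  blockOf : List (ℕ × ℤ) → ℕ → List ℤ
  blockOf I j = reverse (map (λ q → - (+ proj₁ q)) (filterᵇ (isNegᵇ j ∘ proj₂) I))
             ++ map (λ q → + proj₁ q) (filterᵇ (isPosᵇ j ∘ proj₂) I)

  blockOf-∷ʳ-other : (I : List (ℕ × ℤ)) (q : ℕ × ℤ) (j : ℕ) → isNegᵇ j (proj₂ q) ≡ false → isPosᵇ j (proj₂ q) ≡ false →
    blockOf (I ∷ʳ q) j ≡ blockOf I j
  blockOf-∷ʳ-other I q j neg pos
    rewrite filterᵇ-∷ʳ-reject (isNegᵇ j ∘ proj₂) I q neg | filterᵇ-∷ʳ-reject (isPosᵇ j ∘ proj₂) I q pos = refl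

  blockOf-∷ʳ-pos : (I : List (ℕ × ℤ)) (q : ℕ × ℤ) (j : ℕ) → isNegᵇ j (proj₂ q) ≡ false → isPosᵇ j (proj₂ q) ≡ true →
    blockOf (I ∷ʳ q) j ≡ blockOf I j ∷ʳ + proj₁ q
  blockOf-∷ʳ-pos I q j neg pos
    rewrite filterᵇ-∷ʳ-reject (isNegᵇ j ∘ proj₂) I q neg | filterᵇ-∷ʳ-accept (isPosᵇ j ∘ proj₂) I q pos
          | Listₚ.map-++ (λ q → + proj₁ q) (filterᵇ (isPosᵇ j ∘ proj₂) I) (q ∷ []) =
    sym (Listₚ.++-assoc (reverse (map (λ q → - (+ proj₁ q)) (filterᵇ (isNegᵇ j ∘ proj₂) I))) _ _)

  blockOf-∷ʳ-neg : (I : List (ℕ × ℤ)) (q : ℕ × ℤ) (j : ℕ) → isNegᵇ j (proj₂ q) ≡ true → isPosᵇ j (proj₂ q) ≡ false →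
    blockOf (I ∷ʳ q) j ≡ - (+ proj₁ q) ∷ blockOf I j
  blockOf-∷ʳ-neg I q j neg pos
    rewrite filterᵇ-∷ʳ-accept (isNegᵇ j ∘ proj₂) I q neg | filterᵇ-∷ʳ-reject (isPosᵇ j ∘ proj₂) I q pos
          | Listₚ.map-++ (λ q → - (+ proj₁ q)) (filterᵇ (isNegᵇ j ∘ proj₂) I) (q ∷ [])
          | Listₚ.reverse-++ (map (λ q → - (+ proj₁ q)) (filterᵇ (isNegᵇ j ∘ proj₂) I)) (- (+ proj₁ q) ∷ []) = refl

  length-∷ʳ : (f : List ℤ) (x : ℤ) → length (f ∷ʳ x) ≡ suc (length f)
  length-∷ʳ f x = trans (Listₚ.length-++ f) (ℕₚ.+-comm (length f) 1)

  indexed-∷ʳ : (f : List ℤ) (x : ℤ) → indexed (f ∷ʳ x) ≡ indexed f ∷ʳ (suc (length f) , x)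
  indexed-∷ʳ f x = begin
    zip (map suc (upTo (length (f ∷ʳ x)))) (f ∷ʳ x) ≡⟨ cong (λ m → zip (map suc (upTo m)) (f ∷ʳ x)) (length-∷ʳ f x) ⟩
    zip (map suc (upTo (suc n))) (f ∷ʳ x)           ≡⟨ cong (λ l → zip (map suc l) (f ∷ʳ x)) (sym (Listₚ.upTo-∷ʳ n)) ⟩
    zip (map suc (upTo n ∷ʳ n)) (f ∷ʳ x)            ≡⟨ cong (λ l → zip l (f ∷ʳ x)) (Listₚ.map-++ suc (upTo n) (n ∷ [])) ⟩
    zip (map suc (upTo n) ∷ʳ suc n) (f ∷ʳ x)        ≡⟨ zip-∷ʳ (map suc (upTo n)) f (suc n) x length-indices ⟩
    indexed f ∷ʳ (suc n , x)                        ∎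
    where
    open ≡-Reasoning
    n = length f
    length-indices : length (map suc (upTo n)) ≡ n
    length-indices = trans (Listₚ.length-map suc (upTo n)) (Listₚ.length-upTo n)

  block-∷ʳ-other : (f : List ℤ) (x : ℤ) (j : ℕ) → ¬ ∣ x ∣ ≡ j → πblock (f ∷ʳ x) j ≡ πblock f j
  block-∷ʳ-other f x j ≢j rewrite indexed-∷ʳ f x =
    blockOf-∷ʳ-other (indexed f) (suc (length f) , x) j (isNeg-other j x ≢j) (isPos-other j x ≢j)

  block-∷ʳ-pos : (f : List ℤ) (j : ℕ) → πblock (f ∷ʳ + j) j ≡ πblock f j ∷ʳ + suc (length f)
  block-∷ʳ-pos f j rewrite indexed-∷ʳ f (+ j) =
    blockOf-∷ʳ-pos (indexed f) (suc (length f) , + j) j (isNeg-+ j j) (isPos-self j)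

  block-∷ʳ-neg : (f : List ℤ) (i : ℕ) → πblock (f ∷ʳ -[1+ i ]) (suc i) ≡ -[1+ length f ] ∷ πblock f (suc i)
  block-∷ʳ-neg f i rewrite indexed-∷ʳ f -[1+ i ] =
    blockOf-∷ʳ-neg (indexed f) (suc (length f) , -[1+ i ]) (suc i) (isNeg-self i) refl

  block-empty : (f : List ℤ) (j : ℕ) → All (λ y → ¬ ∣ y ∣ ≡ j) f → πblock f j ≡ []
  block-empty f j ≢j = cong₂ _++_
    (cong (reverse ∘ map _) (filterᵇ-none _ (indexed f) (All-zip₂ _ f (All.map (λ {y} → isNeg-other j y) ≢j))))
    (cong (map _) (filterᵇ-none _ (indexed f) (All-zip₂ _ f (All.map (λ {y} → isPos-other j y) ≢j))))

  length-block : (f : List ℤ) (j : ℕ) → length (πblock f j) ≡ mult j f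
  length-block f j = begin
    length (πblock f j)                                                    ≡⟨ Listₚ.length-++ (reverse negatives) ⟩
    length (reverse negatives) + length (map (λ q → + proj₁ q) positives)
      ≡⟨ cong₂ _+_ (trans (Listₚ.length-reverse negatives) (Listₚ.length-map _ (filterᵇ _ (indexed f)))) (Listₚ.length-map _ positives) ⟩
    countᵇ (isNegᵇ j ∘ proj₂) (indexed f) + countᵇ (isPosᵇ j ∘ proj₂) (indexed f)
      ≡⟨ cong₂ _+_ (countᵇ-zip₂ (isNegᵇ j) indices f length-indices) (countᵇ-zip₂ (isPosᵇ j) indices f length-indices) ⟩
    countᵇ (isNegᵇ j) f + countᵇ (isPosᵇ j) f                              ≡⟨ countᵇ-+ (isNegᵇ j) (isPosᵇ j) _ (block-tests j) f ⟩
    mult j f                                                               ∎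
    where
    open ≡-Reasoning
    indices = map suc (upTo (length f))
    negatives = map (λ q → - (+ proj₁ q)) (filterᵇ (isNegᵇ j ∘ proj₂) (indexed f))
    positives = filterᵇ (isPosᵇ j ∘ proj₂) (indexed f)
    length-indices : length indices ≡ length f
    length-indices = trans (Listₚ.length-map suc (upTo (length f))) (Listₚ.length-upTo (length f))

  -- The values ±i occurring in π(f) satisfy 1 ≤ i ≤ n, so they lie strictly between -(n+1) and n+1.
  InRange : ℕ → ℤ → Set
  InRange n y = -[1+ n ] ℤ.< y × y ℤ.< + suc n

  block-InRange : (f : List ℤ) (j : ℕ) → All (InRange (length f)) (πblock f j)
  block-InRange f j = ++⁺
    (All-reverse _ (map⁺ (filter⁺ _ (All.map (λ {q} → neg-InRange (proj₁ q)) index-bound))))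
    (map⁺ (filter⁺ _ (All.map (λ i≤n → ℤ.-<+ , ℤ.+<+ (s≤s i≤n)) index-bound)))
    where
    n = length f
    index-bound : All (λ q → proj₁ q ≤ n) (indexed f)
    index-bound = All-zip₁ (map suc (upTo n)) f
      (subst (All (_≤ n)) (sym (Listₚ.map-upTo suc n)) (applyUpTo⁺₁ suc n (λ i<n → i<n)))
    neg-InRange : (i : ℕ) → i ≤ n → InRange n (- (+ i))
    neg-InRange zero    _   = ℤ.-<+ , ℤ.+<+ (s≤s z≤n)
    neg-InRange (suc i) i≤n = ℤ.-<- i≤n , ℤ.-<+

  -- π(f) only involves the blocks up to max|f_i|; any bound k for the |f_i| does as well.
  πUpTo : ℕ → List ℤ → List ℤ
  πUpTo k f = concat (applyUpTo (πblock f) (suc k))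

  maxℕ-upper : (f : List ℤ) → All (λ y → ∣ y ∣ ≤ maxℕ (map ∣_∣ f)) f
  maxℕ-upper []      = []
  maxℕ-upper (y ∷ f) = ℕₚ.m≤m⊔n ∣ y ∣ _ ∷ All.map (λ p → ℕₚ.≤-trans p (ℕₚ.m≤n⊔m ∣ y ∣ _)) (maxℕ-upper f)

  maxℕ-least : (k : ℕ) (f : List ℤ) → All (λ y → ∣ y ∣ ≤ k) f → maxℕ (map ∣_∣ f) ≤ k
  maxℕ-least k []      []       = z≤n
  maxℕ-least k (y ∷ f) (p ∷ ps) = ℕₚ.⊔-lub p (maxℕ-least k f ps)

  π-πUpTo : (k : ℕ) (f : List ℤ) → All (λ y → ∣ y ∣ ≤ k) f → π f ≡ πUpTo k f
  π-πUpTo k f bounded = begin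
    π f                                                       ≡⟨ cong concat (Listₚ.map-upTo (πblock f) (suc M)) ⟩
    concat (applyUpTo block (suc M))                          ≡⟨ sym (Listₚ.++-identityʳ _) ⟩
    concat (applyUpTo block (suc M)) ++ []                    ≡⟨ cong (concat (applyUpTo block (suc M)) ++_) (sym beyond-max-empty) ⟩
    concat (applyUpTo block (suc M)) ++ concat (applyUpTo (λ i → block (suc M + i)) (k ∸ M))
                                                              ≡⟨ Listₚ.concat-++ (applyUpTo block (suc M)) _ ⟩
    concat (applyUpTo block (suc M) ++ applyUpTo (λ i → block (suc M + i)) (k ∸ M))
                                                              ≡⟨ cong concat (sym (applyUpTo-+ block (suc M) (k ∸ M))) ⟩
    concat (applyUpTo block (suc M + (k ∸ M)))                ≡⟨ cong (λ d → concat (applyUpTo block (suc d))) (ℕₚ.m+[n∸m]≡n (maxℕ-least k f bounded)) ⟩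
    πUpTo k f                                                 ∎
    where
    open ≡-Reasoning
    M = maxℕ (map ∣_∣ f)
    block = πblock f
    beyond-max-empty : concat (applyUpTo (λ i → block (suc M + i)) (k ∸ M)) ≡ []
    beyond-max-empty = concat-applyUpTo-[] _ (k ∸ M) (λ i → block-empty f (suc M + i)
      (All.map (λ {y} y≤M y≡ → ℕₚ.<-irrefl refl (ℕₚ.≤-trans (ℕₚ.m≤m+n (suc M) i) (subst (_≤ M) y≡ y≤M))) (maxℕ-upper f)))

  πUpTo-InRange : (k : ℕ) (f : List ℤ) → All (InRange (length f)) (πUpTo k f)
  πUpTo-InRange k f = concat⁺ (applyUpTo⁺₂ (πblock f) (suc k) (block-InRange f))

  blocksBelow : List ℤ → ℕ → List ℤ
  blocksBelow f j = concat (applyUpTo (πblock f) j)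

  blocksAbove : ℕ → List ℤ → ℕ → List ℤ
  blocksAbove k f j = concat (applyUpTo (λ i → πblock f (suc (j + i))) (k ∸ j))

  πUpTo-split : (k : ℕ) (f : List ℤ) (j : ℕ) → j ≤ k → πUpTo k f ≡ blocksBelow f j ++ (πblock f j ++ blocksAbove k f j)
  πUpTo-split k f j j≤k = trans (cong concat (applyUpTo-split (πblock f) j k j≤k))
    (sym (Listₚ.concat-++ (applyUpTo (πblock f) j) (πblock f j ∷ applyUpTo (λ i → πblock f (suc (j + i))) (k ∸ j))))

  blocksBelow-∷ʳ : (f : List ℤ) (x : ℤ) → blocksBelow (f ∷ʳ x) ∣ x ∣ ≡ blocksBelow f ∣ x ∣
  blocksBelow-∷ʳ f x = cong concat (applyUpTo-cong _ _ ∣ x ∣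
    (λ i i<j → block-∷ʳ-other f x i (λ j≡i → ℕₚ.<-irrefl (sym j≡i) i<j)))

  blocksAbove-∷ʳ : (k : ℕ) (f : List ℤ) (x : ℤ) → blocksAbove k (f ∷ʳ x) ∣ x ∣ ≡ blocksAbove k f ∣ x ∣
  blocksAbove-∷ʳ k f x = cong concat (applyUpTo-cong _ _ (k ∸ ∣ x ∣)
    (λ i _ → block-∷ʳ-other f x (suc (∣ x ∣ + i)) (ℕₚ.m≢1+m+n ∣ x ∣)))

  πUpTo-∷ʳ-pos : (k : ℕ) (f : List ℤ) (j : ℕ) → j ≤ k →
    πUpTo k (f ∷ʳ + j) ≡ (blocksBelow f j ++ πblock f j) ++ + suc (length f) ∷ blocksAbove k f j
  πUpTo-∷ʳ-pos k f j j≤k = begin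
    πUpTo k (f ∷ʳ + j)
      ≡⟨ πUpTo-split k (f ∷ʳ + j) j j≤k ⟩
    blocksBelow (f ∷ʳ + j) j ++ (πblock (f ∷ʳ + j) j ++ blocksAbove k (f ∷ʳ + j) j)
      ≡⟨ cong₂ _++_ (blocksBelow-∷ʳ f (+ j)) (cong₂ _++_ (block-∷ʳ-pos f j) (blocksAbove-∷ʳ k f (+ j))) ⟩
    blocksBelow f j ++ ((πblock f j ∷ʳ new) ++ blocksAbove k f j)
      ≡⟨ cong (blocksBelow f j ++_) (Listₚ.++-assoc (πblock f j) (new ∷ []) (blocksAbove k f j)) ⟩
    blocksBelow f j ++ (πblock f j ++ new ∷ blocksAbove k f j)
      ≡⟨ sym (Listₚ.++-assoc (blocksBelow f j) _ _) ⟩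
    (blocksBelow f j ++ πblock f j) ++ new ∷ blocksAbove k f j ∎
    where
    open ≡-Reasoning
    new = + suc (length f)

  πUpTo-∷ʳ-neg : (k : ℕ) (f : List ℤ) (i : ℕ) → suc i ≤ k →
    πUpTo k (f ∷ʳ -[1+ i ]) ≡ blocksBelow f (suc i) ++ -[1+ length f ] ∷ (πblock f (suc i) ++ blocksAbove k f (suc i))
  πUpTo-∷ʳ-neg k f i i<k = trans (πUpTo-split k (f ∷ʳ -[1+ i ]) (suc i) i<k)
    (cong₂ _++_ (blocksBelow-∷ʳ f -[1+ i ]) (cong₂ _++_ (block-∷ʳ-neg f i) (blocksAbove-∷ʳ k f -[1+ i ])))

  -- The change of ℓ_D(f) when appending +j: one inversion with every entry of a later block.
  ℓDf-∷ʳ-pos : (k : ℕ) (f : List ℤ) (j : ℕ) → All (λ y → ∣ y ∣ ≤ k) f → j ≤ k →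
    ℓDf (f ∷ʳ + j) ≡ ℓDf f + sum (applyUpTo (λ i → mult (suc (j + i)) f) (k ∸ j))
  ℓDf-∷ʳ-pos k f j bounded j≤k = begin
    ℓD (π (f ∷ʳ + j))
      ≡⟨ cong ℓD (π-πUpTo k (f ∷ʳ + j) (∷ʳ⁺ bounded j≤k)) ⟩
    ℓD (πUpTo k (f ∷ʳ + j))
      ≡⟨ cong ℓD (πUpTo-∷ʳ-pos k f j j≤k) ⟩
    ℓD (front ++ + suc (length f) ∷ blocksAbove k f j)
      ≡⟨ ℓD-insert-max front (blocksAbove k f j) (suc (length f)) (All.map proj₂ (subst (All _) split (πUpTo-InRange k f))) ⟩
    ℓD (front ++ blocksAbove k f j) + length (blocksAbove k f j)
      ≡⟨ cong₂ _+_ (cong ℓD (sym (trans (π-πUpTo k f bounded) split))) (length-concat-applyUpTo _ (k ∸ j)) ⟩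
    ℓDf f + sum (applyUpTo (λ i → length (πblock f (suc (j + i)))) (k ∸ j))
      ≡⟨ cong (λ l → ℓDf f + sum l) (applyUpTo-cong _ _ (k ∸ j) (λ i _ → length-block f (suc (j + i)))) ⟩
    ℓDf f + sum (applyUpTo (λ i → mult (suc (j + i)) f) (k ∸ j)) ∎
    where
    open ≡-Reasoning
    front = blocksBelow f j ++ πblock f j
    split : πUpTo k f ≡ front ++ blocksAbove k f j
    split = trans (πUpTo-split k f j j≤k) (sym (Listₚ.++-assoc (blocksBelow f j) _ _))

  -- The change of ℓ_D(f) when appending -(i+1): one inversion with every entry of an
  -- earlier block, plus n from ℓ_B - neg of the new entry -(n+1).
  ℓDf-∷ʳ-neg : (k : ℕ) (f : List ℤ) (i : ℕ) → All (λ y → ∣ y ∣ ≤ k) f → suc i ≤ k →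
    ℓDf (f ∷ʳ -[1+ i ]) ≡ ℓDf f + (sum (applyUpTo (λ j → mult j f) (suc i)) + length f)
  ℓDf-∷ʳ-neg k f i bounded i<k = begin
    ℓD (π (f ∷ʳ -[1+ i ]))
      ≡⟨ cong ℓD (π-πUpTo k (f ∷ʳ -[1+ i ]) (∷ʳ⁺ bounded i<k)) ⟩
    ℓD (πUpTo k (f ∷ʳ -[1+ i ]))
      ≡⟨ cong ℓD (πUpTo-∷ʳ-neg k f i i<k) ⟩
    ℓD (blocksBelow f (suc i) ++ -[1+ length f ] ∷ back)
      ≡⟨ ℓD-insert-min (blocksBelow f (suc i)) back (length f) (All.map proj₁ (subst (All _) split (πUpTo-InRange k f))) ⟩
    ℓD (blocksBelow f (suc i) ++ back) + (length (blocksBelow f (suc i)) + length f)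
      ≡⟨ cong₂ (λ a b → a + (b + length f)) (cong ℓD (sym (trans (π-πUpTo k f bounded) split))) (length-concat-applyUpTo (πblock f) (suc i)) ⟩
    ℓDf f + (sum (applyUpTo (λ j → length (πblock f j)) (suc i)) + length f)
      ≡⟨ cong (λ l → ℓDf f + (sum l + length f)) (applyUpTo-cong _ _ (suc i) (λ j _ → length-block f j)) ⟩
    ℓDf f + (sum (applyUpTo (λ j → mult j f) (suc i)) + length f) ∎
    where
    open ≡-Reasoning
    back = πblock f (suc i) ++ blocksAbove k f (suc i)
    split : πUpTo k f ≡ blocksBelow f (suc i) ++ back
    split = πUpTo-split k f (suc i) i<k

module ContentVectors where
  open import Data.Nat using (_+_)
  open import Data.Nat.ListAction using (sum)
  open import Data.Vec as Vec using (Vec)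
  open import Data.Fin using (Fin; toℕ)
  open ListFacts
  open Blocks using (mult)

  -- v_j (0 beyond the end of v).
  entry : List ℕ → ℕ → ℕ
  entry []      _       = 0
  entry (a ∷ w) zero    = a
  entry (a ∷ w) (suc j) = entry w j

  decrementAt : List ℕ → ℕ → List ℕ
  decrementAt []      _       = []
  decrementAt (a ∷ w) zero    = (a ∸ 1) ∷ w
  decrementAt (a ∷ w) (suc j) = a ∷ decrementAt w j

  incrementAt : List ℕ → ℕ → List ℕ
  incrementAt []      _       = []
  incrementAt (a ∷ w) zero    = suc a ∷ w
  incrementAt (a ∷ w) (suc j) = a ∷ incrementAt w j

  sumBefore : List ℕ → ℕ → ℕ
  sumBefore []      _       = 0
  sumBefore (a ∷ w) zero    = 0
  sumBefore (a ∷ w) (suc j) = a + sumBefore w j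

  sumAfter : List ℕ → ℕ → ℕ
  sumAfter []      _       = 0
  sumAfter (a ∷ w) zero    = sum w
  sumAfter (a ∷ w) (suc j) = sumAfter w j

  nonzeroᵇ : ℕ → Bool
  nonzeroᵇ zero    = false
  nonzeroᵇ (suc _) = true

  eqᵇ : List ℕ → List ℕ → Bool
  eqᵇ []      []      = true
  eqᵇ (a ∷ w) (b ∷ v) = (a ≡ᵇ b) ∧ eqᵇ w v
  eqᵇ _       _       = false

  eqᵇ-sound : (w v : List ℕ) → eqᵇ w v ≡ true → w ≡ v
  eqᵇ-sound []      []      _ = refl
  eqᵇ-sound (a ∷ w) (b ∷ v) e with a ≡ᵇ b in a≡ᵇb
  ... | true = cong₂ _∷_ (ℕₚ.≡ᵇ⇒≡ a b (subst T (sym a≡ᵇb) _)) (eqᵇ-sound w v e)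

  eqᵇ-incrementAt : (w v : List ℕ) (j : ℕ) → j < length w →
    eqᵇ (incrementAt w j) v ≡ nonzeroᵇ (entry v j) ∧ eqᵇ w (decrementAt v j)
  eqᵇ-incrementAt (a ∷ w) []          zero    _         = refl
  eqᵇ-incrementAt (a ∷ w) []          (suc j) _         = refl
  eqᵇ-incrementAt (a ∷ w) (zero ∷ v)  zero    _         = refl
  eqᵇ-incrementAt (a ∷ w) (suc b ∷ v) zero    _         = refl
  eqᵇ-incrementAt (a ∷ w) (b ∷ v)     (suc j) (s≤s j<l) rewrite eqᵇ-incrementAt w v j j<l
    with a ≡ᵇ b | nonzeroᵇ (entry v j)
  ... | true  | _     = refl
  ... | false | true  = refl
  ... | false | false = refl

  content : ℕ → List ℤ → List ℕ
  content k f = applyUpTo (λ j → mult j f) (suc k)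

  hasContent : ℕ → List ℕ → List ℤ → Bool
  hasContent k v f = eqᵇ (content k f) v

  mult-∷ʳ : (j : ℕ) (f : List ℤ) (x : ℤ) → mult j (f ∷ʳ x) ≡ mult j f + indicator (∣ x ∣ ≡ᵇ j)
  mult-∷ʳ j f x = trans (countᵇ-++ absIs f (x ∷ [])) (cong (_+_ (mult j f)) (trans (countᵇ-∷ absIs x []) (ℕₚ.+-identityʳ _)))
    where absIs = λ (y : ℤ) → ∣ y ∣ ≡ᵇ j

  applyUpTo-incrementAt : (c : ℕ → ℕ) (d J : ℕ) → applyUpTo (λ i → c i + indicator (J ≡ᵇ i)) d ≡ incrementAt (applyUpTo c d) J
  applyUpTo-incrementAt c zero    J       = refl
  applyUpTo-incrementAt c (suc d) zero    = cong₂ _∷_ (ℕₚ.+-comm (c 0) 1) (applyUpTo-cong _ _ d (λ i _ → ℕₚ.+-identityʳ (c (suc i))))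
  applyUpTo-incrementAt c (suc d) (suc J) = cong₂ _∷_ (ℕₚ.+-identityʳ (c 0)) (applyUpTo-incrementAt (c ∘ suc) d J)

  content-∷ʳ : (k : ℕ) (f : List ℤ) (x : ℤ) → content k (f ∷ʳ x) ≡ incrementAt (content k f) ∣ x ∣
  content-∷ʳ k f x = trans (applyUpTo-cong _ _ (suc k) (λ j _ → mult-∷ʳ j f x)) (applyUpTo-incrementAt (λ j → mult j f) (suc k) ∣ x ∣)

  hasContent-∷ʳ : (k : ℕ) (v : List ℕ) (f : List ℤ) (x : ℤ) → ∣ x ∣ ≤ k →
    hasContent k v (f ∷ʳ x) ≡ nonzeroᵇ (entry v ∣ x ∣) ∧ hasContent k (decrementAt v ∣ x ∣) f
  hasContent-∷ʳ k v f x x≤k rewrite content-∷ʳ k f x =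
    eqᵇ-incrementAt (content k f) v ∣ x ∣ (subst (∣ x ∣ <_) (sym (Listₚ.length-applyUpTo (λ j → mult j f) (suc k))) (s≤s x≤k))

  sumBefore-at : (A : List ℕ) (c : ℕ) (B : List ℕ) → sumBefore (A ++ c ∷ B) (length A) ≡ sum A
  sumBefore-at []      c B = refl
  sumBefore-at (a ∷ A) c B = cong (_+_ a) (sumBefore-at A c B)

  sumAfter-at : (A : List ℕ) (c : ℕ) (B : List ℕ) → sumAfter (A ++ c ∷ B) (length A) ≡ sum B
  sumAfter-at []      c B = refl
  sumAfter-at (a ∷ A) c B = sumAfter-at A c B

  content-sumBefore : (k : ℕ) (f : List ℤ) (j : ℕ) → j ≤ k → sumBefore (content k f) j ≡ sum (applyUpTo (λ i → mult i f) j)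
  content-sumBefore k f j j≤k rewrite applyUpTo-split (λ i → mult i f) j k j≤k =
    trans (cong (sumBefore vector) (sym (Listₚ.length-applyUpTo (λ i → mult i f) j)))
      (sumBefore-at (applyUpTo (λ i → mult i f) j) (mult j f) (applyUpTo (λ i → mult (suc (j + i)) f) (k ∸ j)))
    where vector = applyUpTo (λ i → mult i f) j ++ mult j f ∷ applyUpTo (λ i → mult (suc (j + i)) f) (k ∸ j)

  content-sumAfter : (k : ℕ) (f : List ℤ) (j : ℕ) → j ≤ k →
    sumAfter (content k f) j ≡ sum (applyUpTo (λ i → mult (suc (j + i)) f) (k ∸ j))
  content-sumAfter k f j j≤k rewrite applyUpTo-split (λ i → mult i f) j k j≤k =
    trans (cong (sumAfter vector) (sym (Listₚ.length-applyUpTo (λ i → mult i f) j)))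
      (sumAfter-at (applyUpTo (λ i → mult i f) j) (mult j f) (applyUpTo (λ i → mult (suc (j + i)) f) (k ∸ j)))
    where vector = applyUpTo (λ i → mult i f) j ++ mult j f ∷ applyUpTo (λ i → mult (suc (j + i)) f) (k ∸ j)

  sumBefore-decrementAt : (v : List ℕ) (j : ℕ) → sumBefore (decrementAt v j) j ≡ sumBefore v j
  sumBefore-decrementAt []      j       = refl
  sumBefore-decrementAt (a ∷ v) zero    = refl
  sumBefore-decrementAt (a ∷ v) (suc j) = cong (_+_ a) (sumBefore-decrementAt v j)

  sumAfter-decrementAt : (v : List ℕ) (j : ℕ) → sumAfter (decrementAt v j) j ≡ sumAfter v j
  sumAfter-decrementAt []      j       = refl
  sumAfter-decrementAt (a ∷ v) zero    = refl
  sumAfter-decrementAt (a ∷ v) (suc j) = sumAfter-decrementAt v j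

  length-decrementAt : (v : List ℕ) (j : ℕ) → length (decrementAt v j) ≡ length v
  length-decrementAt []      j       = refl
  length-decrementAt (a ∷ v) zero    = refl
  length-decrementAt (a ∷ v) (suc j) = cong suc (length-decrementAt v j)

  sum-decrementAt : (v : List ℕ) (j t : ℕ) → entry v j ≡ suc t → sum v ≡ suc (sum (decrementAt v j))
  sum-decrementAt (a ∷ v) zero    t refl = refl
  sum-decrementAt (a ∷ v) (suc j) t e    = trans (cong (_+_ a) (sum-decrementAt v j t e)) (ℕₚ.+-suc a _)

  entry₀-decrementAt : (v : List ℕ) (j : ℕ) → entry (decrementAt v (suc j)) 0 ≡ entry v 0
  entry₀-decrementAt []      j = refl
  entry₀-decrementAt (a ∷ v) j = refl

  sum≡0⇒zeros : (v : List ℕ) → sum v ≡ 0 → v ≡ replicate (length v) 0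
  sum≡0⇒zeros []       _ = refl
  sum≡0⇒zeros (zero ∷ v) e = cong (0 ∷_) (sum≡0⇒zeros v e)

  hasContent-[] : (k : ℕ) → hasContent k (replicate (suc k) 0) [] ≡ true
  hasContent-[] k = zeros (suc k)
    where
    zeros : (m : ℕ) → eqᵇ (applyUpTo (λ _ → 0) m) (replicate m 0) ≡ true
    zeros zero    = refl
    zeros (suc m) = zeros m

  sum-toList : {m : ℕ} (ns : Vec ℕ m) → Vec.sum ns ≡ sum (Vec.toList ns)
  sum-toList Vec.[]       = refl
  sum-toList (x Vec.∷ ns) = cong (_+_ x) (sum-toList ns)

  hasCounts-hasContent : (k : ℕ) (ns : Vec ℕ (suc k)) (f : List ℤ) → hasCounts ns f ≡ hasContent k (Vec.toList ns) f
  hasCounts-hasContent k ns f = trans (cong (Data.List.foldr _∧_ true) (Listₚ.map-tabulate (λ j → j) (λ (j : Fin (suc k)) → mult (toℕ j) f ≡ᵇ Vec.lookup ns j))) (conjunction (λ j → mult j f) ns)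
    where
    conjunction : {m : ℕ} (c : ℕ → ℕ) (ns : Vec ℕ m) →
      Data.List.foldr _∧_ true (Data.List.tabulate (λ (j : Fin m) → c (toℕ j) ≡ᵇ Vec.lookup ns j)) ≡ eqᵇ (applyUpTo c m) (Vec.toList ns)
    conjunction c Vec.[]         = refl
    conjunction c (x Vec.∷ ns) = cong (_∧_ (c 0 ≡ᵇ x)) (conjunction (c ∘ suc) ns)

-- The weighted count of words with a prescribed content, and its recurrence obtained by
-- splitting off the last letter.  The sign weight b is arbitrary (later b = a and b = -a).
module Recurrence (k : ℕ) (p b : ℤ) where
  open import Data.Integer using (_+_; _*_; _^_)
  open import Data.Integer.Tactic.RingSolver using (solve-∀)
  open import Data.Bool.Properties using (∧-zeroʳ; ∧-identityʳ)
  open Sums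
  open ListFacts using (indicator; countᵇ-++; countᵇ-∷)
  open CoxeterLength using (negᵇ)
  open Blocks using (ℓDf-∷ʳ-pos; ℓDf-∷ʳ-neg)
  open ContentVectors

  range-bounded : All (λ x → ∣ x ∣ ≤ k) (range k)
  range-bounded = map⁺ (applyUpTo⁺₁ (λ i → i) (suc (k ℕ.+ k)) (λ {i} → bounded i))
    where
    bounded : (i : ℕ) → i < suc (k ℕ.+ k) → ∣ + i ℤ.- + k ∣ ≤ k
    bounded i (s≤s i≤2k) rewrite ℤₚ.m-n≡m⊖n i k with k ℕₚ.≤? i
    ... | yes k≤i rewrite ℤₚ.⊖-≥ k≤i = ℕₚ.≤-trans (ℕₚ.∸-monoˡ-≤ k i≤2k) (ℕₚ.≤-reflexive (ℕₚ.m+n∸n≡m k k))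
    ... | no  k≰i rewrite ℤₚ.⊖-< (ℕₚ.≰⇒> k≰i) | ℤₚ.∣-i∣≡∣i∣ (+ (k ∸ i)) = ℕₚ.m∸n≤m k i

  negf-∷ʳ : (f : List ℤ) (x : ℤ) → negf (f ∷ʳ x) ≡ negf f ℕ.+ indicator (negᵇ x)
  negf-∷ʳ f x = trans (countᵇ-++ negᵇ f (x ∷ [])) (cong (ℕ._+_ (negf f)) (trans (countᵇ-∷ negᵇ x []) (ℕₚ.+-identityʳ _)))

  weight : List ℤ → ℤ
  weight f = (p ^ ℓDf f) * (b ^ negf f)

  contentSum : ℕ → List ℕ → ℤ
  contentSum n v = ∑[ f ∈ tuples n (range k) ] when (hasContent k v f) (weight f)

  -- The factor by which appending x to a word of length n and content v − e_{|x|}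
  -- multiplies the weight (0 if v_{|x|} = 0, when no such word exists).
  stepFactor : List ℕ → ℕ → ℤ → ℤ
  stepFactor v n (+ j)      = when (nonzeroᵇ (entry v j)) (p ^ sumAfter v j)
  stepFactor v n -[1+ i ]   = when (nonzeroᵇ (entry v (suc i))) ((p ^ (sumBefore v (suc i) ℕ.+ n)) * b)

  weight-∷ʳ-pos : (f : List ℤ) (j : ℕ) → All (λ y → ∣ y ∣ ≤ k) f → j ≤ k → (v : List ℕ) → content k f ≡ decrementAt v j →
    weight (f ∷ʳ + j) ≡ (p ^ sumAfter v j) * weight f
  weight-∷ʳ-pos f j bounded j≤k v f∈v = begin
    (p ^ ℓDf (f ∷ʳ + j)) * (b ^ negf (f ∷ʳ + j))    ≡⟨ cong₂ (λ ℓ m → (p ^ ℓ) * (b ^ m)) length-change (negf-∷ʳ f (+ j)) ⟩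
    (p ^ (ℓDf f ℕ.+ sumAfter v j)) * (b ^ (negf f ℕ.+ 0)) ≡⟨ cong₂ _*_ (ℤₚ.^-distribˡ-+-* p (ℓDf f) _) (cong (b ^_) (ℕₚ.+-identityʳ (negf f))) ⟩
    ((p ^ ℓDf f) * (p ^ sumAfter v j)) * (b ^ negf f) ≡⟨ rearrange (p ^ ℓDf f) _ _ ⟩
    (p ^ sumAfter v j) * weight f                     ∎
    where
    open ≡-Reasoning
    length-change : ℓDf (f ∷ʳ + j) ≡ ℓDf f ℕ.+ sumAfter v j
    length-change = trans (ℓDf-∷ʳ-pos k f j bounded j≤k)
      (cong (ℕ._+_ (ℓDf f)) (trans (sym (content-sumAfter k f j j≤k)) (trans (cong (λ w → sumAfter w j) f∈v) (sumAfter-decrementAt v j))))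
    rearrange : ∀ x y z → (x * y) * z ≡ y * (x * z)
    rearrange = solve-∀

  weight-∷ʳ-neg : (n : ℕ) (f : List ℤ) (i : ℕ) → All (λ y → ∣ y ∣ ≤ k) f → length f ≡ n → suc i ≤ k →
    (v : List ℕ) → content k f ≡ decrementAt v (suc i) →
    weight (f ∷ʳ -[1+ i ]) ≡ ((p ^ (sumBefore v (suc i) ℕ.+ n)) * b) * weight f
  weight-∷ʳ-neg n f i bounded f∈ℤⁿ i<k v f∈v = begin
    (p ^ ℓDf (f ∷ʳ -[1+ i ])) * (b ^ negf (f ∷ʳ -[1+ i ])) ≡⟨ cong₂ (λ ℓ m → (p ^ ℓ) * (b ^ m)) length-change (negf-∷ʳ f -[1+ i ]) ⟩
    (p ^ (ℓDf f ℕ.+ E)) * (b ^ (negf f ℕ.+ 1))            ≡⟨ cong₂ _*_ (ℤₚ.^-distribˡ-+-* p (ℓDf f) E) (ℤₚ.^-distribˡ-+-* b (negf f) 1) ⟩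
    ((p ^ ℓDf f) * (p ^ E)) * ((b ^ negf f) * (b * + 1))   ≡⟨ rearrange (p ^ ℓDf f) (p ^ E) (b ^ negf f) b ⟩
    ((p ^ E) * b) * weight f                               ∎
    where
    open ≡-Reasoning
    E = sumBefore v (suc i) ℕ.+ n
    length-change : ℓDf (f ∷ʳ -[1+ i ]) ≡ ℓDf f ℕ.+ E
    length-change = trans (ℓDf-∷ʳ-neg k f i bounded i<k) (cong (ℕ._+_ (ℓDf f)) (cong₂ ℕ._+_
      (trans (sym (content-sumBefore k f (suc i) i<k)) (trans (cong (λ w → sumBefore w (suc i)) f∈v) (sumBefore-decrementAt v (suc i))))
      f∈ℤⁿ))
    rearrange : ∀ x y z w → (x * y) * (z * (w * + 1)) ≡ (y * w) * (x * z)
    rearrange = solve-∀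

  summand-∷ʳ : (n : ℕ) (v : List ℕ) (f : List ℤ) (x : ℤ) → All (λ y → ∣ y ∣ ≤ k) f → length f ≡ n → ∣ x ∣ ≤ k →
    when (hasContent k v (f ∷ʳ x)) (weight (f ∷ʳ x)) ≡ stepFactor v n x * when (hasContent k (decrementAt v ∣ x ∣) f) (weight f)
  summand-∷ʳ n v f x bounded f∈ℤⁿ x≤k rewrite hasContent-∷ʳ k v f x x≤k with hasContent k (decrementAt v ∣ x ∣) f in f∈v
  ... | false rewrite ∧-zeroʳ (nonzeroᵇ (entry v ∣ x ∣)) = sym (ℤₚ.*-zeroʳ (stepFactor v n x))
  ... | true  rewrite ∧-identityʳ (nonzeroᵇ (entry v ∣ x ∣)) = by-letter x x≤k (eqᵇ-sound _ _ f∈v)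
    where
    by-letter : (x : ℤ) → ∣ x ∣ ≤ k → content k f ≡ decrementAt v ∣ x ∣ →
      when (nonzeroᵇ (entry v ∣ x ∣)) (weight (f ∷ʳ x)) ≡ stepFactor v n x * weight f
    by-letter (+ j) j≤k f∈v' with entry v j
    ... | zero  = sym (ℤₚ.*-zeroˡ (weight f))
    ... | suc _ = weight-∷ʳ-pos f j bounded j≤k v f∈v'
    by-letter -[1+ i ] i<k f∈v' with entry v (suc i)
    ... | zero  = sym (ℤₚ.*-zeroˡ (weight f))
    ... | suc _ = weight-∷ʳ-neg n f i bounded f∈ℤⁿ i<k v f∈v'

  contentSum-suc : (n : ℕ) (v : List ℕ) →
    contentSum (suc n) v ≡ ∑[ x ∈ range k ] (stepFactor v n x * contentSum n (decrementAt v ∣ x ∣))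
  contentSum-suc n v = begin
    contentSum (suc n) v
      ≡⟨ ∑-tuples-∷ʳ (range k) n _ ⟩
    ∑[ f ∈ tuples n (range k) ] ∑[ x ∈ range k ] when (hasContent k v (f ∷ʳ x)) (weight (f ∷ʳ x))
      ≡⟨ ∑-congᴬ (tuples n (range k)) (All.map (λ {f} (bounded , f∈ℤⁿ) → ∑-congᴬ (range k)
           (All.map (λ {x} → summand-∷ʳ n v f x bounded f∈ℤⁿ) range-bounded)) (tuples-All (range k) range-bounded n)) ⟩
    ∑[ f ∈ tuples n (range k) ] ∑[ x ∈ range k ] (stepFactor v n x * when (hasContent k (decrementAt v ∣ x ∣) f) (weight f))
      ≡⟨ ∑-swap (tuples n (range k)) (range k) _ ⟩
    ∑[ x ∈ range k ] ∑[ f ∈ tuples n (range k) ] (stepFactor v n x * when (hasContent k (decrementAt v ∣ x ∣) f) (weight f))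
      ≡⟨ ∑-cong (range k) (λ x → ∑-*ˡ (tuples n (range k)) (stepFactor v n x) _) ⟩
    ∑[ x ∈ range k ] (stepFactor v n x * contentSum n (decrementAt v ∣ x ∣)) ∎
    where open ≡-Reasoning

module QAlgebra where
  open import Data.Integer using (_+_; _*_; _-_; _^_)
  open import Data.Integer.Tactic.RingSolver using (solve-∀)
  open import Data.Nat.ListAction using (sum)
  open Sums
  open ListFacts using (applyUpTo-+)
  open ContentVectors using (entry; sumBefore; sumAfter)

  prodℤ-++ : (xs ys : List ℤ) → prodℤ (xs ++ ys) ≡ prodℤ xs * prodℤ ys
  prodℤ-++ []       ys = sym (ℤₚ.*-identityˡ _)
  prodℤ-++ (x ∷ xs) ys = trans (cong (x *_) (prodℤ-++ xs ys)) (sym (ℤₚ.*-assoc x _ _))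

  poch-suc : (x p : ℤ) (m : ℕ) → poch x p (suc m) ≡ poch x p m * (+ 1 - x * p ^ m)
  poch-suc x p m = begin
    prodℤ (map factor (upTo (suc m)))             ≡⟨ cong (prodℤ ∘ map factor) (sym (Listₚ.upTo-∷ʳ m)) ⟩
    prodℤ (map factor (upTo m ∷ʳ m))              ≡⟨ cong prodℤ (Listₚ.map-++ factor (upTo m) (m ∷ [])) ⟩
    prodℤ (map factor (upTo m) ++ factor m ∷ [])  ≡⟨ prodℤ-++ (map factor (upTo m)) (factor m ∷ []) ⟩
    poch x p m * (factor m * + 1)                 ≡⟨ cong (poch x p m *_) (ℤₚ.*-identityʳ (factor m)) ⟩
    poch x p m * factor m                         ∎
    where
    open ≡-Reasoning
    factor = λ i → + 1 - x * (p ^ i)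

  ∑-applyUpTo : {A : Set} (h : ℕ → A) (c : ℕ) (g : A → ℤ) → sumOver (applyUpTo h c) g ≡ ∑[ i ∈ upTo c ] g (h i)
  ∑-applyUpTo h c g = trans (cong (λ l → sumOver l g) (sym (Listₚ.map-upTo h c))) (∑-map h (upTo c) g)

  ∑-upTo-suc : (m : ℕ) (g : ℕ → ℤ) → sumOver (upTo (suc m)) g ≡ g 0 + ∑[ i ∈ upTo m ] g (suc i)
  ∑-upTo-suc m g = cong (_+_ (g 0)) (∑-applyUpTo suc m g)

  ∑-upTo-∷ʳ : (m : ℕ) (g : ℕ → ℤ) → sumOver (upTo (suc m)) g ≡ sumOver (upTo m) g + g m
  ∑-upTo-∷ʳ m g = trans (cong (λ l → sumOver l g) (sym (Listₚ.upTo-∷ʳ m)))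
    (trans (∑-++ (upTo m) (m ∷ []) g) (cong (_+_ (sumOver (upTo m) g)) (ℤₚ.+-identityʳ (g m))))

  qint-+ : (p : ℤ) (a c : ℕ) → qint (a ℕ.+ c) p ≡ qint a p + p ^ a * qint c p
  qint-+ p a c = begin
    sumOver (applyUpTo (λ i → i) (a ℕ.+ c)) (p ^_)           ≡⟨ cong (λ l → sumOver l (p ^_)) (applyUpTo-+ (λ i → i) a c) ⟩
    sumOver (upTo a ++ applyUpTo (a ℕ.+_) c) (p ^_)          ≡⟨ ∑-++ (upTo a) _ (p ^_) ⟩
    qint a p + sumOver (applyUpTo (a ℕ.+_) c) (p ^_)         ≡⟨ cong (_+_ (qint a p)) (∑-applyUpTo (a ℕ.+_) c (p ^_)) ⟩
    qint a p + ∑[ i ∈ upTo c ] (p ^ (a ℕ.+ i))               ≡⟨ cong (_+_ (qint a p)) (∑-cong (upTo c) (λ i → ℤₚ.^-distribˡ-+-* p a i)) ⟩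
    qint a p + ∑[ i ∈ upTo c ] (p ^ a * p ^ i)               ≡⟨ cong (_+_ (qint a p)) (∑-*ˡ (upTo c) (p ^ a) (p ^_)) ⟩
    qint a p + p ^ a * qint c p                              ∎
    where open ≡-Reasoning

  pairUp : (ℤ → ℤ) → ℕ → ℤ
  pairUp φ i = φ (+ suc i) + φ -[1+ i ]

  ∑-range : (k : ℕ) (φ : ℤ → ℤ) → sumOver (range k) φ ≡ φ (+ 0) + sumOver (upTo k) (pairUp φ)
  ∑-range k φ = trans (∑-map _ (upTo (suc (k ℕ.+ k))) φ) (shifted k φ)
    where
    shifted : (k : ℕ) (φ : ℤ → ℤ) → ∑[ i ∈ upTo (suc (k ℕ.+ k)) ] φ (+ i - + k) ≡ φ (+ 0) + sumOver (upTo k) (pairUp φ)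
    shifted zero    φ = refl
    shifted (suc k) φ = begin
      sumOver (upTo (suc (suc (k ℕ.+ suc k)))) ψ
        ≡⟨ cong (λ m → sumOver (upTo (suc (suc m))) ψ) (ℕₚ.+-suc k k) ⟩
      sumOver (upTo (suc (suc (suc N)))) ψ
        ≡⟨ ∑-upTo-suc (suc (suc N)) ψ ⟩
      ψ 0 + sumOver (upTo (suc (suc N))) (ψ ∘ suc)
        ≡⟨ cong (_+_ (ψ 0)) (∑-upTo-∷ʳ (suc N) (ψ ∘ suc)) ⟩
      ψ 0 + (sumOver (upTo (suc N)) (ψ ∘ suc) + ψ (suc (suc N)))
        ≡⟨ cong₂ (λ a c → a + (c + ψ (suc (suc N)))) (cong φ (ℤₚ.+-identityˡ -[1+ k ])) (∑-cong (upTo (suc N)) (λ i → cong φ (shift (+ 1) (+ i) (+ k)))) ⟩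
      φ -[1+ k ] + (∑[ i ∈ upTo (suc N) ] φ (+ i - + k) + ψ (suc (suc N)))
        ≡⟨ cong₂ (λ a c → φ -[1+ k ] + (a + c)) (shifted k φ) (cong φ (top (+ 1) (+ k))) ⟩
      φ -[1+ k ] + ((φ (+ 0) + sumOver (upTo k) (pairUp φ)) + φ (+ suc k))
        ≡⟨ regroup (φ -[1+ k ]) (φ (+ 0)) (sumOver (upTo k) (pairUp φ)) (φ (+ suc k)) ⟩
      φ (+ 0) + (sumOver (upTo k) (pairUp φ) + pairUp φ k)
        ≡⟨ cong (_+_ (φ (+ 0))) (sym (∑-upTo-∷ʳ k (pairUp φ))) ⟩
      φ (+ 0) + sumOver (upTo (suc k)) (pairUp φ) ∎
      where
      open ≡-Reasoning
      N = k ℕ.+ k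
      ψ = λ i → φ (+ i - + suc k)
      shift : ∀ o i k → (o + i) - (o + k) ≡ i - k
      shift = solve-∀
      top : ∀ o k → (o + (o + (k + k))) - (o + k) ≡ o + k
      top = solve-∀
      regroup : ∀ a b c d → a + ((b + c) + d) ≡ b + (c + (d + a))
      regroup = solve-∀

  ∑-qint-sumAfter : (p : ℤ) (w : List ℕ) → ∑[ i ∈ upTo (length w) ] (qint (entry w i) p * p ^ sumAfter w i) ≡ qint (sum w) p
  ∑-qint-sumAfter p []      = refl
  ∑-qint-sumAfter p (a ∷ w) = begin
    ∑[ i ∈ upTo (suc (length w)) ] (qint (entry (a ∷ w) i) p * p ^ sumAfter (a ∷ w) i)
      ≡⟨ ∑-upTo-suc (length w) (λ i → qint (entry (a ∷ w) i) p * p ^ sumAfter (a ∷ w) i) ⟩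
    qint a p * p ^ sum w + ∑[ i ∈ upTo (length w) ] (qint (entry w i) p * p ^ sumAfter w i)
      ≡⟨ cong (_+_ (qint a p * p ^ sum w)) (∑-qint-sumAfter p w) ⟩
    qint a p * p ^ sum w + qint (sum w) p   ≡⟨ swap (qint a p) (p ^ sum w) (qint (sum w) p) ⟩
    qint (sum w) p + p ^ sum w * qint a p   ≡⟨ sym (qint-+ p (sum w) a) ⟩
    qint (sum w ℕ.+ a) p                    ≡⟨ cong (λ m → qint m p) (ℕₚ.+-comm (sum w) a) ⟩
    qint (a ℕ.+ sum w) p                    ∎
    where
    open ≡-Reasoning
    swap : ∀ x y z → x * y + z ≡ z + y * x
    swap = solve-∀

  ∑-qint-sumBefore : (p : ℤ) (w : List ℕ) → ∑[ i ∈ upTo (length w) ] (qint (entry w i) p * p ^ sumBefore w i) ≡ qint (sum w) p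
  ∑-qint-sumBefore p []      = refl
  ∑-qint-sumBefore p (a ∷ w) = begin
    ∑[ i ∈ upTo (suc (length w)) ] (qint (entry (a ∷ w) i) p * p ^ sumBefore (a ∷ w) i)
      ≡⟨ ∑-upTo-suc (length w) (λ i → qint (entry (a ∷ w) i) p * p ^ sumBefore (a ∷ w) i) ⟩
    qint a p * + 1 + ∑[ i ∈ upTo (length w) ] (qint (entry w i) p * p ^ (a ℕ.+ sumBefore w i))
      ≡⟨ cong₂ _+_ (ℤₚ.*-identityʳ (qint a p)) (trans (∑-cong (upTo (length w)) factor-out) (∑-*ˡ (upTo (length w)) (p ^ a) _)) ⟩
    qint a p + p ^ a * ∑[ i ∈ upTo (length w) ] (qint (entry w i) p * p ^ sumBefore w i)
      ≡⟨ cong (λ s → qint a p + p ^ a * s) (∑-qint-sumBefore p w) ⟩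
    qint a p + p ^ a * qint (sum w) p       ≡⟨ sym (qint-+ p a (sum w)) ⟩
    qint (a ℕ.+ sum w) p                    ∎
    where
    open ≡-Reasoning
    leftComm : ∀ x y z → x * (y * z) ≡ y * (x * z)
    leftComm = solve-∀
    factor-out : (i : ℕ) → qint (entry w i) p * p ^ (a ℕ.+ sumBefore w i) ≡ p ^ a * (qint (entry w i) p * p ^ sumBefore w i)
    factor-out i = trans (cong (qint (entry w i) p *_) (ℤₚ.^-distribˡ-+-* p a (sumBefore w i))) (leftComm (qint (entry w i) p) (p ^ a) (p ^ sumBefore w i))

-- Induction on n via the recurrence: each letter x contributes a term whose sum over
-- all letters is [n+1]_p (1 + b p^n).
module ProductFormula (k : ℕ) (p b : ℤ) where
  open import Data.Integer using (_+_; _*_; _-_; _^_)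
  open import Data.Integer.Tactic.RingSolver using (solve-∀)
  open import Data.Nat.ListAction using (sum)
  open Sums
  open ContentVectors
  open QAlgebra
  open Recurrence k p b

  qfacts : List ℕ → ℤ
  qfacts v = prodℤ (map (λ m → qfact m p) v)

  pochNeg : ℕ → ℤ
  pochNeg m = poch (- b) p m

  qfacts-decrementAt : (v : List ℕ) (j t : ℕ) → entry v j ≡ suc t → qfacts v ≡ qint (suc t) p * qfacts (decrementAt v j)
  qfacts-decrementAt (a ∷ w) zero    t refl = ℤₚ.*-assoc (qint (suc t) p) (qfact t p) (qfacts w)
  qfacts-decrementAt (a ∷ w) (suc j) t e    = trans (cong (qfact a p *_) (qfacts-decrementAt w j t e)) (leftComm (qfact a p) (qint (suc t) p) (qfacts (decrementAt w j)))
    where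
    leftComm : ∀ x y z → x * (y * z) ≡ y * (x * z)
    leftComm = solve-∀

  qfacts-zeros : (m : ℕ) → qfacts (replicate m 0) ≡ + 1
  qfacts-zeros zero    = refl
  qfacts-zeros (suc m) = cong (+ 1 *_) (qfacts-zeros m)

  -- The normalised contribution of the last letter x.  For x = 0 it absorbs the factor
  -- 1 + b p^{n_0 - 1} by which (-b;p)_{n_0} changes when n_0 is decremented.
  letterTerm : List ℕ → ℕ → ℤ → ℤ
  letterTerm v n (+ zero)   = (qint (entry v 0) p * p ^ sumAfter v 0) * (+ 1 + b * p ^ (entry v 0 ∸ 1))
  letterTerm v n (+ suc j)  = qint (entry v (suc j)) p * p ^ sumAfter v (suc j)
  letterTerm v n -[1+ i ]   = qint (entry v (suc i)) p * ((p ^ (sumBefore v (suc i) ℕ.+ n)) * b)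

  -- The normalising factors after decrementing an entry of v factor off a q-integer q and
  -- a Pochhammer ratio c; the induction hypothesis then applies to the remaining factor.
  factor-step : (v v' : List ℕ) (q c s H : ℤ) → qfacts v ≡ q * qfacts v' → pochNeg (entry v 0) ≡ pochNeg (entry v' 0) * c →
    (qfacts v * pochNeg (entry v 0)) * (s * H) ≡ ((q * s) * c) * ((qfacts v' * H) * pochNeg (entry v' 0))
  factor-step v v' q c s H qfacts-v pochNeg-v rewrite qfacts-v | pochNeg-v = regroup q (qfacts v') (pochNeg (entry v' 0)) c s H
    where
    regroup : ∀ q P N c s H → ((q * P) * (N * c)) * (s * H) ≡ ((q * s) * c) * ((P * H) * N)
    regroup = solve-∀

  -- Letters x with v_{|x|} = 0 contribute nothing on either side.
  vanishing₁ : ∀ X H s c R → X * (+ 0 * H) ≡ ((+ 0 * s) * c) * R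
  vanishing₁ = solve-∀

  vanishing₂ : ∀ X H s R → X * (+ 0 * H) ≡ (+ 0 * s) * R
  vanishing₂ = solve-∀

  -- A letter x ≠ 0 with v_{|x|} = t+1: decrementing v_{|x|} leaves (-b;p)_{n_0} unchanged.
  decrement-step : {n : ℕ} →
    (∀ v' → length v' ≡ suc k → sum v' ≡ n → (qfacts v' * contentSum n v') * pochNeg (entry v' 0) ≡ qfact n p * pochNeg n) →
    (v : List ℕ) → length v ≡ suc k → sum v ≡ suc n → (j t : ℕ) → entry v j ≡ suc t → entry (decrementAt v j) 0 ≡ entry v 0 → (s : ℤ) →
    (qfacts v * pochNeg (entry v 0)) * (s * contentSum n (decrementAt v j)) ≡ (qint (suc t) p * s) * (qfact n p * pochNeg n)
  decrement-step {n} IH v lv sv j t v-entry same-entry₀ s = begin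
    (qfacts v * pochNeg (entry v 0)) * (s * contentSum n v')
      ≡⟨ factor-step v v' (qint (suc t) p) (+ 1) s (contentSum n v') (qfacts-decrementAt v j t v-entry)
           (trans (cong pochNeg (sym same-entry₀)) (sym (ℤₚ.*-identityʳ (pochNeg (entry v' 0))))) ⟩
    ((qint (suc t) p * s) * + 1) * ((qfacts v' * contentSum n v') * pochNeg (entry v' 0))
      ≡⟨ cong₂ _*_ (ℤₚ.*-identityʳ (qint (suc t) p * s)) (IH v' (trans (length-decrementAt v j) lv) (ℕₚ.suc-injective (trans (sym (sum-decrementAt v j t v-entry)) sv))) ⟩
    (qint (suc t) p * s) * (qfact n p * pochNeg n) ∎
    where
    open ≡-Reasoning
    v' = decrementAt v j

  letter-step : (n : ℕ) →
    (∀ v' → length v' ≡ suc k → sum v' ≡ n → (qfacts v' * contentSum n v') * pochNeg (entry v' 0) ≡ qfact n p * pochNeg n) →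
    (v : List ℕ) → length v ≡ suc k → sum v ≡ suc n → (x : ℤ) →
    (qfacts v * pochNeg (entry v 0)) * (stepFactor v n x * contentSum n (decrementAt v ∣ x ∣)) ≡ letterTerm v n x * (qfact n p * pochNeg n)
  letter-step n IH (a ∷ w) lv sv (+ zero) with a
  ... | zero  = vanishing₁ (qfacts (0 ∷ w) * pochNeg 0) (contentSum n (0 ∷ w)) (p ^ sum w) (+ 1 + b * p ^ 0) (qfact n p * pochNeg n)
  ... | suc t = begin
    (qfacts (suc t ∷ w) * pochNeg (suc t)) * (p ^ sum w * contentSum n (t ∷ w))
      ≡⟨ factor-step (suc t ∷ w) (t ∷ w) (qint (suc t) p) (+ 1 + b * p ^ t) (p ^ sum w) (contentSum n (t ∷ w))
           (qfacts-decrementAt (suc t ∷ w) 0 t refl) (trans (poch-suc (- b) p t) (cong (pochNeg t *_) (negate b (p ^ t)))) ⟩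
    ((qint (suc t) p * p ^ sum w) * (+ 1 + b * p ^ t)) * ((qfacts (t ∷ w) * contentSum n (t ∷ w)) * pochNeg t)
      ≡⟨ cong (((qint (suc t) p * p ^ sum w) * (+ 1 + b * p ^ t)) *_) (IH (t ∷ w) lv (ℕₚ.suc-injective sv)) ⟩
    ((qint (suc t) p * p ^ sum w) * (+ 1 + b * p ^ t)) * (qfact n p * pochNeg n) ∎
    where
    open ≡-Reasoning
    negate : ∀ b q → + 1 - (- b) * q ≡ + 1 + b * q
    negate = solve-∀
  letter-step n IH v lv sv (+ suc j) with entry v (suc j) in v-entry
  ... | zero  = vanishing₂ (qfacts v * pochNeg (entry v 0)) (contentSum n (decrementAt v (suc j))) (p ^ sumAfter v (suc j)) (qfact n p * pochNeg n)
  ... | suc t = decrement-step IH v lv sv (suc j) t v-entry (entry₀-decrementAt v j) (p ^ sumAfter v (suc j))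
  letter-step n IH v lv sv -[1+ i ] with entry v (suc i) in v-entry
  ... | zero  = vanishing₂ (qfacts v * pochNeg (entry v 0)) (contentSum n (decrementAt v (suc i))) ((p ^ (sumBefore v (suc i) ℕ.+ n)) * b) (qfact n p * pochNeg n)
  ... | suc t = decrement-step IH v lv sv (suc i) t v-entry (entry₀-decrementAt v i) ((p ^ (sumBefore v (suc i) ℕ.+ n)) * b)

  letterTerms-identity : (a S n : ℕ) → a ℕ.+ S ≡ suc n →
    (qint a p * p ^ S) * (+ 1 + b * p ^ (a ∸ 1)) + (qint S p + (p ^ (a ℕ.+ n) * b) * qint S p) ≡ qint (suc n) p * (+ 1 - (- b) * p ^ n)
  letterTerms-identity zero    S n refl = simplify (p ^ S) (+ 1 + b * p ^ 0) (qint (suc n) p) (p ^ n) b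
    where
    simplify : ∀ X c Q P b → (+ 0 * X) * c + (Q + (P * b) * Q) ≡ Q * (+ 1 - (- b) * P)
    simplify = solve-∀
  letterTerms-identity (suc t) S n t+S≡n rewrite sym (ℕₚ.suc-injective t+S≡n) = begin
    (qt * pS) * (+ 1 + b * p ^ t) + (qS + (p ^ (suc t ℕ.+ (t ℕ.+ S)) * b) * qS)
      ≡⟨ cong (λ z → (qt * pS) * (+ 1 + b * p ^ t) + (qS + (z * b) * qS))
           (trans (ℤₚ.^-distribˡ-+-* p (suc t) (t ℕ.+ S)) (cong (p ^ suc t *_) (ℤₚ.^-distribˡ-+-* p t S))) ⟩
    (qt * pS) * (+ 1 + b * p ^ t) + (qS + ((p ^ suc t * (p ^ t * pS)) * b) * qS)
      ≡⟨ regroup qt pS b (p ^ t) qS (p ^ suc t) ⟩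
    (qS + pS * qt) + (b * (p ^ t * pS)) * (qt + p ^ suc t * qS)
      ≡⟨ sym (cong₂ (λ x y → x + (b * (p ^ t * pS)) * y) split-right (qint-+ p (suc t) S)) ⟩
    qint (suc (t ℕ.+ S)) p + (b * (p ^ t * pS)) * qint (suc (t ℕ.+ S)) p
      ≡⟨ cong (λ z → qint (suc (t ℕ.+ S)) p + (b * z) * qint (suc (t ℕ.+ S)) p) (sym (ℤₚ.^-distribˡ-+-* p t S)) ⟩
    qint (suc (t ℕ.+ S)) p + (b * p ^ (t ℕ.+ S)) * qint (suc (t ℕ.+ S)) p
      ≡⟨ factor (qint (suc (t ℕ.+ S)) p) b (p ^ (t ℕ.+ S)) ⟩
    qint (suc (t ℕ.+ S)) p * (+ 1 - (- b) * p ^ (t ℕ.+ S)) ∎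
    where
    open ≡-Reasoning
    qt = qint (suc t) p
    qS = qint S p
    pS = p ^ S
    split-right : qint (suc (t ℕ.+ S)) p ≡ qS + pS * qt
    split-right = trans (cong (λ m → qint m p) (trans (cong suc (ℕₚ.+-comm t S)) (sym (ℕₚ.+-suc S t)))) (qint-+ p S (suc t))
    regroup : ∀ qt pS b pt qS pst →
      (qt * pS) * (+ 1 + b * pt) + (qS + ((pst * (pt * pS)) * b) * qS) ≡ (qS + pS * qt) + (b * (pt * pS)) * (qt + pst * qS)
    regroup = solve-∀
    factor : ∀ Q b P → Q + (b * P) * Q ≡ Q * (+ 1 - (- b) * P)
    factor = solve-∀

  ∑-letterTerm : (n : ℕ) (v : List ℕ) → length v ≡ suc k → sum v ≡ suc n →
    sumOver (range k) (letterTerm v n) ≡ qint (suc n) p * (+ 1 - (- b) * p ^ n)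
  ∑-letterTerm n (a ∷ w) lv sv = begin
    sumOver (range k) (letterTerm v n)
      ≡⟨ ∑-range k (letterTerm v n) ⟩
    letterTerm v n (+ 0) + sumOver (upTo k) (pairUp (letterTerm v n))
      ≡⟨ cong (_+_ (letterTerm v n (+ 0))) (trans (∑-cong (upTo k) pair) (∑-+ (upTo k) after before)) ⟩
    letterTerm v n (+ 0) + (sumOver (upTo k) after + sumOver (upTo k) before)
      ≡⟨ cong (λ z → letterTerm v n (+ 0) + (sumOver (upTo k) after + z)) (∑-*ˡ (upTo k) (p ^ (a ℕ.+ n) * b) _) ⟩
    letterTerm v n (+ 0) + (sumOver (upTo k) after + (p ^ (a ℕ.+ n) * b) * ∑[ i ∈ upTo k ] (qint (entry w i) p * p ^ sumBefore w i))
      ≡⟨ cong₂ (λ x y → letterTerm v n (+ 0) + (x + (p ^ (a ℕ.+ n) * b) * y))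
           (trans (cong (λ m → ∑[ i ∈ upTo m ] (qint (entry w i) p * p ^ sumAfter w i)) (sym lw)) (∑-qint-sumAfter p w))
           (trans (cong (λ m → ∑[ i ∈ upTo m ] (qint (entry w i) p * p ^ sumBefore w i)) (sym lw)) (∑-qint-sumBefore p w)) ⟩
    letterTerm v n (+ 0) + (qint (sum w) p + (p ^ (a ℕ.+ n) * b) * qint (sum w) p)
      ≡⟨ letterTerms-identity a (sum w) n sv ⟩
    qint (suc n) p * (+ 1 - (- b) * p ^ n) ∎
    where
    open ≡-Reasoning
    v = a ∷ w
    lw : length w ≡ k
    lw = ℕₚ.suc-injective lv
    after before : ℕ → ℤ
    after  i = qint (entry w i) p * p ^ sumAfter w i
    before i = (p ^ (a ℕ.+ n) * b) * (qint (entry w i) p * p ^ sumBefore w i)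
    rearrange : ∀ q x y b → q * ((x * y) * b) ≡ (x * b) * (q * y)
    rearrange = solve-∀
    exchange : (s : ℕ) → (a ℕ.+ s) ℕ.+ n ≡ (a ℕ.+ n) ℕ.+ s
    exchange s = trans (ℕₚ.+-assoc a s n) (trans (cong (ℕ._+_ a) (ℕₚ.+-comm s n)) (sym (ℕₚ.+-assoc a n s)))
    pair : (i : ℕ) → pairUp (letterTerm v n) i ≡ after i + before i
    pair i = cong (_+_ (after i)) (trans
      (cong (λ e → qint (entry w i) p * (e * b)) (trans (cong (p ^_) (exchange (sumBefore w i))) (ℤₚ.^-distribˡ-+-* p (a ℕ.+ n) (sumBefore w i))))
      (rearrange (qint (entry w i) p) (p ^ (a ℕ.+ n)) (p ^ sumBefore w i) b))

  closedForm : (n : ℕ) (v : List ℕ) → length v ≡ suc k → sum v ≡ n →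
    (qfacts v * contentSum n v) * pochNeg (entry v 0) ≡ qfact n p * pochNeg n
  closedForm zero v lv sv rewrite trans (sum≡0⇒zeros v sv) (cong (λ m → replicate m 0) lv) | qfacts-zeros (suc k) =
    cong (λ c → (+ 1 * (when c (weight []) + + 0)) * + 1) (hasContent-[] k)
  closedForm (suc n) v lv sv = begin
    (qfacts v * contentSum (suc n) v) * pochNeg (entry v 0)
      ≡⟨ cong (λ z → (qfacts v * z) * pochNeg (entry v 0)) (contentSum-suc n v) ⟩
    (qfacts v * sumOver (range k) terms) * pochNeg (entry v 0)
      ≡⟨ swap₂₃ (qfacts v) _ (pochNeg (entry v 0)) ⟩
    (qfacts v * pochNeg (entry v 0)) * sumOver (range k) terms
      ≡⟨ sym (∑-*ˡ (range k) (qfacts v * pochNeg (entry v 0)) terms) ⟩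
    ∑[ x ∈ range k ] ((qfacts v * pochNeg (entry v 0)) * terms x)
      ≡⟨ ∑-cong (range k) (letter-step n (closedForm n) v lv sv) ⟩
    ∑[ x ∈ range k ] (letterTerm v n x * (qfact n p * pochNeg n))
      ≡⟨ ∑-*ʳ (range k) (letterTerm v n) _ ⟩
    sumOver (range k) (letterTerm v n) * (qfact n p * pochNeg n)
      ≡⟨ cong (_* (qfact n p * pochNeg n)) (∑-letterTerm n v lv sv) ⟩
    (qint (suc n) p * (+ 1 - (- b) * p ^ n)) * (qfact n p * pochNeg n)
      ≡⟨ regroup (qint (suc n) p) (+ 1 - (- b) * p ^ n) (qfact n p) (pochNeg n) ⟩
    (qint (suc n) p * qfact n p) * (pochNeg n * (+ 1 - (- b) * p ^ n))
      ≡⟨ cong ((qint (suc n) p * qfact n p) *_) (sym (poch-suc (- b) p n)) ⟩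
    qfact (suc n) p * pochNeg (suc n) ∎
    where
    open ≡-Reasoning
    terms : ℤ → ℤ
    terms x = stepFactor v n x * contentSum n (decrementAt v ∣ x ∣)
    swap₂₃ : ∀ x y z → (x * y) * z ≡ (x * z) * y
    swap₂₃ = solve-∀
    regroup : ∀ a c d e → (a * c) * (d * e) ≡ (a * d) * (e * c)
    regroup = solve-∀

module Parity where
  open import Data.Integer using (_+_; _*_; _^_)
  open import Data.Integer.Tactic.RingSolver using (solve-∀)
  open import Data.Bool.Properties using (∧-zeroʳ; ∧-identityʳ)
  open import Data.Nat.DivMod using (_%_; [m+n]%n≡m%n)
  open import Data.Vec using (Vec; toList)
  open Sums
  open ContentVectors using (hasContent; hasCounts-hasContent)

  evenᵇ-+2 : (m : ℕ) → evenᵇ (suc (suc m)) ≡ evenᵇ m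
  evenᵇ-+2 m = cong (_≡ᵇ 0) (trans (cong (_% 2) (ℕₚ.+-comm 2 m)) ([m+n]%n≡m%n m 2))

  neg-^ : (a : ℤ) (m : ℕ) → (- a) ^ m ≡ (if evenᵇ m then a ^ m else - (a ^ m))
  neg-^ a zero          = refl
  neg-^ a (suc zero)    = odd₁ a
    where
    odd₁ : ∀ a → (- a) * + 1 ≡ - (a * + 1)
    odd₁ = solve-∀
  neg-^ a (suc (suc m)) rewrite evenᵇ-+2 m with evenᵇ m | neg-^ a m
  ... | true  | ih rewrite ih = even a (a ^ m)
    where
    even : ∀ a x → (- a) * ((- a) * x) ≡ a * (a * x)
    even = solve-∀
  ... | false | ih rewrite ih = odd a (a ^ m)
    where
    odd : ∀ a x → (- a) * ((- a) * (- x)) ≡ - (a * (a * x))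
    odd = solve-∀

  twice-even : (h : Bool) (m : ℕ) (X a : ℤ) →
    + 2 * when (evenᵇ m ∧ h) (X * a ^ m) ≡ when h (X * a ^ m) + when h (X * (- a) ^ m)
  twice-even false m X a rewrite ∧-zeroʳ (evenᵇ m) = refl
  twice-even true  m X a rewrite ∧-identityʳ (evenᵇ m) | neg-^ a m with evenᵇ m
  ... | true  = double (X * a ^ m)
    where
    double : ∀ y → + 2 * y ≡ y + y
    double = solve-∀
  ... | false = cancel X (a ^ m)
    where
    cancel : ∀ X y → + 2 * + 0 ≡ X * y + X * (- y)
    cancel = solve-∀

  twice-genSum : (n k : ℕ) (ns : Vec ℕ (suc k)) (p a : ℤ) →
    + 2 * genSum n ns p a ≡ Recurrence.contentSum k p a n (toList ns) + Recurrence.contentSum k p (- a) n (toList ns)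
  twice-genSum n k ns p a = begin
    + 2 * sumOver (Zne n ns) weightₐ
      ≡⟨ cong (+ 2 *_) (∑-filterᵇ _ words weightₐ) ⟩
    + 2 * ∑[ f ∈ words ] when (evenᵇ (negf f) ∧ hasCounts ns f) (weightₐ f)
      ≡⟨ sym (∑-*ˡ words (+ 2) _) ⟩
    ∑[ f ∈ words ] (+ 2 * when (evenᵇ (negf f) ∧ hasCounts ns f) (weightₐ f))
      ≡⟨ ∑-cong words (λ f → trans (cong (λ h → + 2 * when (evenᵇ (negf f) ∧ h) (weightₐ f)) (hasCounts-hasContent k ns f))
                                    (twice-even (hasContent k (toList ns) f) (negf f) (p ^ ℓDf f) a)) ⟩
    ∑[ f ∈ words ] (when (hasContent k (toList ns) f) (weightₐ f) + when (hasContent k (toList ns) f) (Recurrence.weight k p (- a) f))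
      ≡⟨ ∑-+ words _ _ ⟩
    Recurrence.contentSum k p a n (toList ns) + Recurrence.contentSum k p (- a) n (toList ns) ∎
    where
    open ≡-Reasoning
    words = tuples n (range k)
    weightₐ = Recurrence.weight k p a

open import Data.Integer using (_+_; _*_)
open import Data.Integer.Tactic.RingSolver using (solve-∀)
open import Data.Vec using (Vec; _∷_; head; toList)
open import Data.Vec.Properties using (length-toList)
open ContentVectors using (sum-toList)
open Recurrence using (contentSum)

closedForm : (n k : ℕ) (ns : Vec ℕ (suc k)) → Data.Vec.sum ns ≡ n → (p b : ℤ) →
  (prodℤ (map (λ m → qfact m p) (toList ns)) * contentSum k p b n (toList ns)) * poch (- b) p (head ns) ≡ qfact n p * poch (- b) p n
closedForm n k (n₀ ∷ ns) Σns≡n p b =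
  ProductFormula.closedForm k p b n (n₀ ∷ toList ns) (cong suc (length-toList ns)) (trans (sym (sum-toList (n₀ ∷ ns))) Σns≡n)

lemma6p1 : (n k : ℕ) (ns : Vec ℕ (suc k)) → Data.Vec.sum ns ≡ n → (p a : ℤ) →
    (+ 2) * prodℤ (map (λ m → qfact m p) (toList ns)) * poch a p (head ns) * poch (- a) p (head ns)
      * genSum n ns p a
    ≡ qfact n p * (poch a p n * poch (- a) p (head ns) + poch (- a) p n * poch a p (head ns))
lemma6p1 n k ns Σns≡n p a = begin
  (((+ 2 * P) * P₊) * P₋) * genSum n ns p a        ≡⟨ move-two P P₊ P₋ (genSum n ns p a) ⟩
  ((P * P₊) * P₋) * (+ 2 * genSum n ns p a)        ≡⟨ cong (((P * P₊) * P₋) *_) (Parity.twice-genSum n k ns p a) ⟩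
  ((P * P₊) * P₋) * (H₊ + H₋)                      ≡⟨ distribute P P₊ P₋ H₊ H₋ ⟩
  P₊ * ((P * H₊) * P₋) + P₋ * ((P * H₋) * P₊)      ≡⟨ cong₂ (λ x y → P₊ * x + P₋ * y) (closedForm n k ns Σns≡n p a) at-minus-a ⟩
  P₊ * (qfact n p * poch (- a) p n) + P₋ * (qfact n p * poch a p n)
                                                  ≡⟨ collect P₊ (qfact n p) (poch (- a) p n) P₋ (poch a p n) ⟩
  qfact n p * (poch a p n * P₋ + poch (- a) p n * P₊) ∎
  where
  open ≡-Reasoning
  P  = prodℤ (map (λ m → qfact m p) (toList ns))
  P₊ = poch a p (head ns)
  P₋ = poch (- a) p (head ns)
  H₊ = contentSum k p a n (toList ns)
  H₋ = contentSum k p (- a) n (toList ns)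
  -- The closed form at b = -a, with - - a = a.
  at-minus-a : (P * H₋) * P₊ ≡ qfact n p * poch a p n
  at-minus-a = subst (λ c → (P * H₋) * poch c p (head ns) ≡ qfact n p * poch c p n) (ℤₚ.neg-involutive a)
    (closedForm n k ns Σns≡n p (- a))
  move-two : ∀ P P₊ P₋ G → (((+ 2 * P) * P₊) * P₋) * G ≡ ((P * P₊) * P₋) * (+ 2 * G)
  move-two = solve-∀
  distribute : ∀ P P₊ P₋ H₊ H₋ → ((P * P₊) * P₋) * (H₊ + H₋) ≡ P₊ * ((P * H₊) * P₋) + P₋ * ((P * H₋) * P₊)
  distribute = solve-∀
  collect : ∀ P₊ Q x P₋ y → P₊ * (Q * x) + P₋ * (Q * y) ≡ Q * (y * P₋ + x * P₊)
  collect = solve-∀
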